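{- For $u,v\in\mathfrak{H}^1$, we have $\delta(R(u,v))=R(\delta(u),v)+R(u,\delta(v))$.
   Context: $\mathfrak{H}^1=\mathbb{Q}\langle z_k\mid k\ge1\rangle\cong\mathbb{Q}+\mathbb{Q}\langle x,y\rangle y$ via $z_k=x^{k-1}y$, with harmonic product $\ast$ and shuffle product $\sqcup\!\sqcup$. $\varphi(w)=w\ast z_2-w\sqcup\!\sqcup z_2$, $R(u,v)=\varphi(u\ast v)-\varphi(u)\ast v-u\ast\varphi(v)$, and $\delta(w)=\big(\tfrac12\mathbf{1}_{w=(yx)u}-\tfrac12\mathbf{1}_{w=(xy)u}+\tfrac14\mathbf{1}_{w=(yy)u}\big)u+\tfrac12\big(\sum_{w=u(yyx)u'}-\sum_{w=u(xyy)u'}\big)uyu'$ (a derivation for $\ast$). -}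

module Defs where

open import Data.Nat as ℕ using (ℕ; zero; suc)
open import Data.Integer using (+_)
open import Data.Rational using (ℚ; 0ℚ; 1ℚ; ½; -½; _/_) renaming (_+_ to _+ℚ_; _*_ to _*ℚ_; -_ to -ℚ_)
open import Data.List using (List; []; _∷_; _++_; map; concatMap; replicate; [_])
open import Data.Maybe using (Maybe; just; nothing)
open import Data.Product using (_×_; _,_)
open import Data.Empty using (⊥)
open import Relation.Nullary using (yes; no; ¬_)
open import Relation.Binary.PropositionalEquality using (_≡_; refl)
open import Relation.Binary.Definitions using (DecidableEquality)
import Data.List.Properties as LP

data Letter : Set where
  x y : Letter

_≟L_ : DecidableEquality Letter
x ≟L x = yes refl
x ≟L y = no λ ()
y ≟L x = no λ ()
y ≟L y = yes refl

Word : Set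
Word = List Letter

_≟W_ : DecidableEquality Word
_≟W_ = LP.≡-dec _≟L_

z : ℕ → Word
z k = replicate (k ℕ.∸ 1) x ++ (y ∷ [])

-- H^1 words: empty, or ending in y  (exactly the words z_{k1}...z_{kn})
data EndsY : Word → Set where
  end-y : EndsY (y ∷ [])
  cons  : ∀ {l w} → EndsY w → EndsY (l ∷ w)

data H1Word : Word → Set where
  empty : H1Word []
  endsY : ∀ {w} → EndsY w → H1Word w

-- Q⟨x,y⟩ : finite formal Q-linear combinations of words.
-- Two combinations are equal iff all coefficients agree.

Poly : Set
Poly = List (ℚ × Word)

coeff : Poly → Word → ℚ
coeff [] w = 0ℚ
coeff ((c , v) ∷ p) w with v ≟W w
... | yes _ = c +ℚ coeff p w
... | no  _ = coeff p w

infix 4 _≈_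
_≈_ : Poly → Poly → Set
p ≈ q = ∀ w → coeff p w ≡ coeff q w

InH1 : Poly → Set
InH1 p = ∀ w → ¬ H1Word w → coeff p w ≡ 0ℚ

infixl 6 _⊕_ _⊖_
_⊕_ : Poly → Poly → Poly
p ⊕ q = p ++ q

scale : ℚ → Poly → Poly
scale a p = map (λ { (c , w) → (a *ℚ c , w) }) p

neg : Poly → Poly
neg = scale (-ℚ 1ℚ)

_⊖_ : Poly → Poly → Poly
p ⊖ q = p ⊕ neg q

mono : Word → Poly
mono w = [ (1ℚ , w) ]

lin : (Word → Poly) → Poly → Poly
lin f p = concatMap (λ { (c , w) → scale c (f w) }) p

bilin : (Word → Word → Poly) → Poly → Poly → Poly
bilin f p q = concatMap (λ { (c , u) → concatMap (λ { (d , v) → scale (c *ℚ d) (f u v) }) q }) p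

-- Harmonic (stuffle) product on H^1, via the z-alphabet.
-- A z-word is a list of indices k ≥ 1 (standing for z_k).

parseGo : ℕ → Word → Maybe (List ℕ)
parseGo zero    []      = just []
parseGo (suc _) []      = nothing
parseGo a       (x ∷ w) = parseGo (suc a) w
parseGo a       (y ∷ w) = Data.Maybe.map (suc a ∷_) (parseGo 0 w)

parse : Word → Maybe (List ℕ)
parse = parseGo 0

unparse : List ℕ → Word
unparse []      = []
unparse (k ∷ u) = z k ++ unparse u

qsh : List ℕ → List ℕ → List (List ℕ)
qsh []      v       = [ v ]
qsh (a ∷ u) []      = [ a ∷ u ]
qsh (a ∷ u) (b ∷ v) =
  map (a ∷_) (qsh u (b ∷ v)) ++ map (b ∷_) (qsh (a ∷ u) v) ++ map ((a ℕ.+ b) ∷_) (qsh u v)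

-- harmonic product of words (defined on H^1 words; extended by 0 outside H^1,
-- which never matters below since all arguments lie in H^1)
harmW : Word → Word → Poly
harmW u v with parse u | parse v
... | just zu | just zv = map (λ t → (1ℚ , unparse t)) (qsh zu zv)
... | _       | _       = []

shW : Word → Word → List Word
shW []      v       = [ v ]
shW (a ∷ u) []      = [ a ∷ u ]
shW (a ∷ u) (b ∷ v) = map (a ∷_) (shW u (b ∷ v)) ++ map (b ∷_) (shW (a ∷ u) v)

infixl 7 _✱_ _⧢_
_✱_ : Poly → Poly → Poly
_✱_ = bilin harmW

_⧢_ : Poly → Poly → Poly
_⧢_ = bilin (λ u v → map (λ t → (1ℚ , t)) (shW u v))

z₂ : Poly
z₂ = mono (z 2)

φ : Poly → Poly
φ w = (w ✱ z₂) ⊖ (w ⧢ z₂)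

R : Poly → Poly → Poly
R u v = (φ (u ✱ v) ⊖ (φ u ✱ v)) ⊖ (u ✱ φ v)

¼ : ℚ
¼ = + 1 / 4

δhead : Word → Poly
δhead (y ∷ x ∷ u) = [ (½ , u) ]
δhead (x ∷ y ∷ u) = [ (-½ , u) ]
δhead (y ∷ y ∷ u) = [ (¼ , u) ]
δhead _           = []

splits : Word → List (Word × Word)
splits []      = [ ([] , []) ]
splits (l ∷ w) = ([] , l ∷ w) ∷ map (λ { (u , v) → (l ∷ u , v) }) (splits w)

δmid : Word → Word → Poly
δmid u (y ∷ y ∷ x ∷ u') = [ (½ , u ++ y ∷ u') ]
δmid u (x ∷ y ∷ y ∷ u') = [ (-½ , u ++ y ∷ u') ]
δmid u _                = []

δW : Word → Poly
δW w = δhead w ++ concatMap (λ { (u , v) → δmid u v }) (splits w)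

δ : Poly → Poly
δ = lin δW

module Submission where

-- On H¹, δ is a derivation of the harmonic product ✱, and so is the weight operator W,
-- W w = |w| w for a word w of length |w|. Since δ(xy) = -½ and δ(p ⧢ xy) = δp ⧢ xy - ½ p - W p,
-- it follows that δ ∘ φ = φ ∘ δ + W. Expanding R(u,v) = φ(u ✱ v) - φ(u) ✱ v - u ✱ φ(v) with
-- these three rules, the W-terms cancel and R(δu, v) + R(u, δv) remains. The derivation
-- properties are proved on z-words, where ✱ is the quasi-shuffle product. Polynomials are
-- compared through their coefficient functions, on which each operator acts by an explicit formula.

open import Data.Empty using (⊥; ⊥-elim)
open import Data.List using (List; []; _∷_; _++_; map; concatMap; replicate)
import Data.List.Properties as List
open import Data.Maybe as Maybe using (Maybe; just; nothing)
import Data.Maybe.Properties as Maybe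
open import Data.Nat as ℕ using (ℕ; zero; suc)
import Data.Nat.Properties as ℕ
open import Data.Product using (_×_; _,_; curry)
open import Data.Rational using (ℚ; 0ℚ; 1ℚ; ½; -½; _+_; _*_; -_; _-_)
import Data.Rational.Properties as ℚ
open import Data.Rational.Solver using (module +-*-Solver)
open import Algebra.Bundles using (CommutativeMonoid)
open import Algebra.Properties.CommutativeSemigroup
  (CommutativeMonoid.commutativeSemigroup ℚ.+-0-commutativeMonoid) using (interchange; x∙yz≈y∙xz)
open import Function using (_∘_; const)
open import Relation.Binary.PropositionalEquality
  using (_≡_; _≢_; refl; sym; trans; cong; cong₂; subst; _≗_; module ≡-Reasoning)
open import Relation.Nullary using (yes; no; ¬_; Dec)

open import Defs
open +-*-Solver
open ≡-Reasoning

-- Coefficient functions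

-- A linear operator L on ℚ⟨x,y⟩ is represented by the operator Lᶜ on coefficient functions
-- with coeff (L p) ≗ Lᶜ (coeff p).
Coeffs : Set → Set
Coeffs A = A → ℚ

infixl 8 _·_
_·_ : ∀ {A : Set} → Coeffs (List A) → A → Coeffs (List A)
(f · a) s = f (a ∷ s)

𝟙 : Word → Coeffs Word
𝟙 v = coeff (mono v)

coeff-∷ : ∀ c v p w → coeff ((c , v) ∷ p) w ≡ c * 𝟙 v w + coeff p w
coeff-∷ c v p w with v ≟W w
... | yes _ = solve 2 (λ c a → c :+ a := c :* (con 1ℚ :+ con 0ℚ) :+ a) refl c (coeff p w)
... | no _  = solve 2 (λ c a → a := c :* con 0ℚ :+ a) refl c (coeff p w)

coeff-++ : ∀ p q w → coeff (p ++ q) w ≡ coeff p w + coeff q w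
coeff-++ []            q w = sym (ℚ.+-identityˡ (coeff q w))
coeff-++ ((c , v) ∷ p) q w = begin
  coeff ((c , v) ∷ p ++ q) w                  ≡⟨ coeff-∷ c v (p ++ q) w ⟩
  c * 𝟙 v w + coeff (p ++ q) w                ≡⟨ cong (c * 𝟙 v w +_) (coeff-++ p q w) ⟩
  c * 𝟙 v w + (coeff p w + coeff q w)         ≡⟨ ℚ.+-assoc (c * 𝟙 v w) (coeff p w) (coeff q w) ⟨
  c * 𝟙 v w + coeff p w + coeff q w           ≡⟨ cong (_+ coeff q w) (coeff-∷ c v p w) ⟨
  coeff ((c , v) ∷ p) w + coeff q w           ∎

coeff-scale : ∀ a p w → coeff (scale a p) w ≡ a * coeff p w
coeff-scale a []            w = sym (ℚ.*-zeroʳ a)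
coeff-scale a ((c , v) ∷ p) w = begin
  coeff ((a * c , v) ∷ scale a p) w           ≡⟨ coeff-∷ (a * c) v (scale a p) w ⟩
  a * c * 𝟙 v w + coeff (scale a p) w         ≡⟨ cong (a * c * 𝟙 v w +_) (coeff-scale a p w) ⟩
  a * c * 𝟙 v w + a * coeff p w               ≡⟨ solve 4 (λ a c i b → a :* c :* i :+ a :* b := a :* (c :* i :+ b)) refl
                                                   a c (𝟙 v w) (coeff p w) ⟩
  a * (c * 𝟙 v w + coeff p w)                 ≡⟨ cong (a *_) (coeff-∷ c v p w) ⟨
  a * coeff ((c , v) ∷ p) w                   ∎

coeff-⊖ : ∀ p q w → coeff (p ⊖ q) w ≡ coeff p w - coeff q w
coeff-⊖ p q w = begin
  coeff (p ⊖ q) w                       ≡⟨ coeff-++ p (neg q) w ⟩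
  coeff p w + coeff (neg q) w           ≡⟨ cong (coeff p w +_) (coeff-scale (- 1ℚ) q w) ⟩
  coeff p w + - 1ℚ * coeff q w
    ≡⟨ solve 2 (λ a b → a :+ :- con 1ℚ :* b := a :- b) refl (coeff p w) (coeff q w) ⟩
  coeff p w - coeff q w                 ∎

coeff-single : ∀ c u w → coeff ((c , u) ∷ []) w ≡ c * 𝟙 u w
coeff-single c u w = trans (coeff-∷ c u [] w) (ℚ.+-identityʳ (c * 𝟙 u w))

𝟙-refl : ∀ v → 𝟙 v v ≡ 1ℚ
𝟙-refl v with v ≟W v
... | yes _   = refl
... | no v≢v  = ⊥-elim (v≢v refl)

𝟙-≢ : ∀ {v w} → v ≢ w → 𝟙 v w ≡ 0ℚ
𝟙-≢ {v} {w} v≢w with v ≟W w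
... | yes v≡w = ⊥-elim (v≢w v≡w)
... | no _    = refl

𝟙-∷ : ∀ l u w → 𝟙 (l ∷ u) (l ∷ w) ≡ 𝟙 u w
𝟙-∷ l u w = by-cases (u ≟W w)
  where
  by-cases : Dec (u ≡ w) → 𝟙 (l ∷ u) (l ∷ w) ≡ 𝟙 u w
  by-cases (yes refl) = trans (𝟙-refl (l ∷ u)) (sym (𝟙-refl u))
  by-cases (no u≢w)   = trans (𝟙-≢ {l ∷ u} {l ∷ w} (λ e → u≢w (List.∷-injectiveʳ e))) (sym (𝟙-≢ u≢w))

𝟙-++ : ∀ p u w → 𝟙 (p ++ u) (p ++ w) ≡ 𝟙 u w
𝟙-++ []      u w = refl
𝟙-++ (l ∷ p) u w = trans (𝟙-∷ l (p ++ u) (p ++ w)) (𝟙-++ p u w)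

𝟙ℒ : Letter → Letter → ℚ
𝟙ℒ x x = 1ℚ
𝟙ℒ x y = 0ℚ
𝟙ℒ y x = 0ℚ
𝟙ℒ y y = 1ℚ

𝟙-∷-∷ : ∀ a b u w → 𝟙 (a ∷ u) (b ∷ w) ≡ 𝟙ℒ a b * 𝟙 u w
𝟙-∷-∷ x x u w = trans (𝟙-∷ x u w) (sym (ℚ.*-identityˡ (𝟙 u w)))
𝟙-∷-∷ x y u w = sym (ℚ.*-zeroˡ (𝟙 u w))
𝟙-∷-∷ y x u w = sym (ℚ.*-zeroˡ (𝟙 u w))
𝟙-∷-∷ y y u w = trans (𝟙-∷ y u w) (sym (ℚ.*-identityˡ (𝟙 u w)))

prefix : Letter → Poly → Poly
prefix l = map (λ (c , v) → (c , l ∷ v))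

coeff-prefix : ∀ l p b w → coeff (prefix l p) (b ∷ w) ≡ 𝟙ℒ l b * coeff p w
coeff-prefix l []            b w = sym (ℚ.*-zeroʳ (𝟙ℒ l b))
coeff-prefix l ((c , v) ∷ p) b w = begin
  coeff ((c , l ∷ v) ∷ prefix l p) (b ∷ w)     ≡⟨ coeff-∷ c (l ∷ v) (prefix l p) (b ∷ w) ⟩
  c * 𝟙 (l ∷ v) (b ∷ w) + coeff (prefix l p) (b ∷ w)
    ≡⟨ cong₂ (λ i q → c * i + q) (𝟙-∷-∷ l b v w) (coeff-prefix l p b w) ⟩
  c * (𝟙ℒ l b * 𝟙 v w) + 𝟙ℒ l b * coeff p w
    ≡⟨ solve 4 (λ c l i a → c :* (l :* i) :+ l :* a := l :* (c :* i :+ a)) refl c (𝟙ℒ l b) (𝟙 v w) (coeff p w) ⟩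
  𝟙ℒ l b * (c * 𝟙 v w + coeff p w)           ≡⟨ cong (𝟙ℒ l b *_) (coeff-∷ c v p w) ⟨
  𝟙ℒ l b * coeff ((c , v) ∷ p) w             ∎

coeff-prefix-[] : ∀ l p → coeff (prefix l p) [] ≡ 0ℚ
coeff-prefix-[] l []            = refl
coeff-prefix-[] l ((c , v) ∷ p) = trans (coeff-∷ c (l ∷ v) (prefix l p) [])
  (trans (cong (c * 0ℚ +_) (coeff-prefix-[] l p)) (trans (ℚ.+-identityʳ (c * 0ℚ)) (ℚ.*-zeroʳ c)))

units : List Word → Poly
units = map (1ℚ ,_)

coeff-units-++ : ∀ L₁ L₂ w → coeff (units (L₁ ++ L₂)) w ≡ coeff (units L₁) w + coeff (units L₂) w
coeff-units-++ L₁ L₂ w = trans (cong (λ p → coeff p w) (List.map-++ (1ℚ ,_) L₁ L₂)) (coeff-++ (units L₁) (units L₂) w)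

units-map-∷ : ∀ a L → units (map (a ∷_) L) ≡ prefix a (units L)
units-map-∷ a []      = refl
units-map-∷ a (v ∷ L) = cong ((1ℚ , a ∷ v) ∷_) (units-map-∷ a L)

coeff-units-map-∷ : ∀ a L b w → coeff (units (map (a ∷_) L)) (b ∷ w) ≡ 𝟙ℒ a b * coeff (units L) w
coeff-units-map-∷ a L b w = trans (cong (λ p → coeff p (b ∷ w)) (units-map-∷ a L)) (coeff-prefix a (units L) b w)

coeff-units-map-∷-[] : ∀ a L → coeff (units (map (a ∷_) L)) [] ≡ 0ℚ
coeff-units-map-∷-[] a L = trans (cong (λ p → coeff p []) (units-map-∷ a L)) (coeff-prefix-[] a (units L))

record IsLinear {A B : Set} (T : Coeffs A → Coeffs B) : Set where
  field
    cong-≗ : ∀ {f g} → f ≗ g → T f ≗ T g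
    linear : ∀ c f g → T (λ v → c * f v + g v) ≗ λ w → c * T f w + T g w

  0-homo : T (const 0ℚ) ≗ const 0ℚ
  0-homo w = trans (linear (- 1ℚ) (const 0ℚ) (const 0ℚ) w)
                   (solve 1 (λ a → :- con 1ℚ :* a :+ a := con 0ℚ) refl (T (const 0ℚ) w))

  *-homo : ∀ c f → T (λ v → c * f v) ≗ λ w → c * T f w
  *-homo c f w = begin
    T (λ v → c * f v) w                    ≡⟨ cong-≗ (λ v → sym (ℚ.+-identityʳ (c * f v))) w ⟩
    T (λ v → c * f v + 0ℚ) w               ≡⟨ linear c f (const 0ℚ) w ⟩
    c * T f w + T (const 0ℚ) w             ≡⟨ cong (c * T f w +_) (0-homo w) ⟩
    c * T f w + 0ℚ                         ≡⟨ ℚ.+-identityʳ (c * T f w) ⟩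
    c * T f w                              ∎

  +-homo : ∀ f g → T (λ v → f v + g v) ≗ λ w → T f w + T g w
  +-homo f g w = begin
    T (λ v → f v + g v) w                  ≡⟨ cong-≗ (λ v → cong (_+ g v) (sym (ℚ.*-identityˡ (f v)))) w ⟩
    T (λ v → 1ℚ * f v + g v) w             ≡⟨ linear 1ℚ f g w ⟩
    1ℚ * T f w + T g w                     ≡⟨ cong (_+ T g w) (ℚ.*-identityˡ (T f w)) ⟩
    T f w + T g w                          ∎

  sub-homo : ∀ f g → T (λ v → f v - g v) ≗ λ w → T f w - T g w
  sub-homo f g w = begin
    T (λ v → f v - g v) w
      ≡⟨ cong-≗ (λ v → solve 2 (λ a b → a :- b := :- con 1ℚ :* b :+ a) refl (f v) (g v)) w ⟩
    T (λ v → - 1ℚ * g v + f v) w           ≡⟨ linear (- 1ℚ) g f w ⟩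
    - 1ℚ * T g w + T f w                   ≡⟨ solve 2 (λ a b → :- con 1ℚ :* b :+ a := a :- b) refl (T f w) (T g w) ⟩
    T f w - T g w                          ∎

  *-sub-homo : ∀ a f b g → T (λ v → a * f v - b * g v) ≗ λ w → a * T f w - b * T g w
  *-sub-homo a f b g w = trans (sub-homo _ _ w) (cong₂ _-_ (*-homo a f w) (*-homo b g w))

scaled-isLinear : ∀ {A B} {T : Coeffs A → Coeffs B} c → IsLinear T → IsLinear (λ f w → c * T f w)
scaled-isLinear {T = T} c L = record
  { cong-≗ = λ f≗g w → cong (c *_) (L.cong-≗ f≗g w)
  ; linear = λ d f g w → trans (cong (c *_) (L.linear d f g w))
      (solve 4 (λ c d a b → c :* (d :* a :+ b) := d :* (c :* a) :+ c :* b) refl c d (T f w) (T g w))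
  }
  where module L = IsLinear L

record IsBilinear {A : Set} (T : Coeffs A → Coeffs A → Coeffs A) : Set where
  field
    linearˡ : ∀ g → IsLinear (λ f → T f g)
    linearʳ : ∀ f → IsLinear (T f)

coeff-concatMap : (G : ℚ × Word → Poly) {T : Coeffs Word → Coeffs Word} → IsLinear T →
  (∀ c v → coeff (G (c , v)) ≗ λ w → c * T (𝟙 v) w) →
  ∀ p → coeff (concatMap G p) ≗ T (coeff p)
coeff-concatMap G L G-coeff []            w = sym (IsLinear.0-homo L w)
coeff-concatMap G {T} L G-coeff ((c , v) ∷ p) w = begin
  coeff (G (c , v) ++ concatMap G p) w           ≡⟨ coeff-++ (G (c , v)) (concatMap G p) w ⟩
  coeff (G (c , v)) w + coeff (concatMap G p) w  ≡⟨ cong₂ _+_ (G-coeff c v w) (coeff-concatMap G L G-coeff p w) ⟩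
  c * T (𝟙 v) w + T (coeff p) w                  ≡⟨ IsLinear.linear L c (𝟙 v) (coeff p) w ⟨
  T (λ u → c * 𝟙 v u + coeff p u) w              ≡⟨ IsLinear.cong-≗ L (λ u → coeff-∷ c v p u) w ⟨
  T (coeff ((c , v) ∷ p)) w                      ∎

coeff-lin : (F : Word → Poly) {T : Coeffs Word → Coeffs Word} → IsLinear T →
  (∀ v → coeff (F v) ≗ T (𝟙 v)) → ∀ p → coeff (lin F p) ≗ T (coeff p)
coeff-lin F L F-coeff = coeff-concatMap _ L λ c v w →
  trans (coeff-scale c (F v) w) (cong (c *_) (F-coeff v w))

coeff-bilin : (F : Word → Word → Poly) {T : Coeffs Word → Coeffs Word → Coeffs Word} → IsBilinear T →
  (∀ u v → coeff (F u v) ≗ T (𝟙 u) (𝟙 v)) → ∀ p q → coeff (bilin F p q) ≗ T (coeff p) (coeff q)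
coeff-bilin F {T} B F-coeff p q = coeff-concatMap _ (linearˡ (coeff q)) (λ c u →
  coeff-concatMap _ (scaled-isLinear c (linearʳ (𝟙 u))) (λ d v w → begin
    coeff (scale (c * d) (F u v)) w   ≡⟨ coeff-scale (c * d) (F u v) w ⟩
    c * d * coeff (F u v) w           ≡⟨ cong (c * d *_) (F-coeff u v w) ⟩
    c * d * T (𝟙 u) (𝟙 v) w           ≡⟨ solve 3 (λ c d a → c :* d :* a := d :* (c :* a)) refl c d (T (𝟙 u) (𝟙 v) w) ⟩
    d * (c * T (𝟙 u) (𝟙 v) w)         ∎) q) p
  where open IsBilinear B

𝟙-∷-isLinear : ∀ {T : Coeffs Word → Coeffs Word} → IsLinear T → ∀ a u b →
  T (𝟙 (a ∷ u) · b) ≗ λ w → 𝟙ℒ a b * T (𝟙 u) w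
𝟙-∷-isLinear L a u b w = trans (IsLinear.cong-≗ L (𝟙-∷-∷ a b u) w) (IsLinear.*-homo L (𝟙ℒ a b) (𝟙 u) w)

linear-0 : ∀ c → 0ℚ ≡ c * 0ℚ + 0ℚ
linear-0 c = sym (trans (ℚ.+-identityʳ (c * 0ℚ)) (ℚ.*-zeroʳ c))

linear-+ : ∀ c a b d e → c * a + b + (c * d + e) ≡ c * (a + d) + (b + e)
linear-+ = solve 5 (λ c a b d e → c :* a :+ b :+ (c :* d :+ e) := c :* (a :+ d) :+ (b :+ e)) refl

linear-+₃ : ∀ c a b d e p q → c * a + b + (c * d + e) + (c * p + q) ≡ c * (a + d + p) + (b + e + q)
linear-+₃ = solve 7 (λ c a b d e p q → c :* a :+ b :+ (c :* d :+ e) :+ (c :* p :+ q)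
                                    := c :* (a :+ d :+ p) :+ (b :+ e :+ q)) refl

data EndsX : Word → Set where
  here  : EndsX (x ∷ [])
  there : ∀ {l w} → EndsX w → EndsX (l ∷ w)

EndsX-x^ : ∀ k → EndsX (replicate (suc k) x)
EndsX-x^ zero    = here
EndsX-x^ (suc k) = there (EndsX-x^ k)

EndsX-++ : ∀ p {w} → EndsX w → EndsX (p ++ w)
EndsX-++ []      e = e
EndsX-++ (l ∷ p) e = there (EndsX-++ p e)

-- A word lies outside H¹ exactly when it ends in x.
SupportedOnH¹ : Coeffs Word → Set
SupportedOnH¹ f = ∀ {w} → EndsX w → f w ≡ 0ℚ

supportedOnH¹-∷ : ∀ {f} l → SupportedOnH¹ f → SupportedOnH¹ (f · l)
supportedOnH¹-∷ l f-supp e = f-supp (there e)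

EndsX⇒¬H1Word : ∀ {w} → EndsX w → ¬ H1Word w
EndsX⇒¬H1Word e (endsY e′) = disjoint e e′
  where
  disjoint : ∀ {w} → EndsX w → EndsY w → ⊥
  disjoint here       (cons ())
  disjoint (there ()) end-y
  disjoint (there e)  (cons e′) = disjoint e e′

coeff-supportedOnH¹ : ∀ p → InH1 p → SupportedOnH¹ (coeff p)
coeff-supportedOnH¹ p p∈H¹ e = p∈H¹ _ (EndsX⇒¬H1Word e)

-- Shuffles with y and xy, and δ, on coefficient functions

shuffle-yᶜ : Coeffs Word → Coeffs Word
shuffle-yᶜ f []      = 0ℚ
shuffle-yᶜ f (x ∷ w) = shuffle-yᶜ (f · x) w
shuffle-yᶜ f (y ∷ w) = shuffle-yᶜ (f · y) w + f w

shuffle-xyᶜ : Coeffs Word → Coeffs Word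
shuffle-xyᶜ f []      = 0ℚ
shuffle-xyᶜ f (x ∷ w) = shuffle-xyᶜ (f · x) w + shuffle-yᶜ f w
shuffle-xyᶜ f (y ∷ w) = shuffle-xyᶜ (f · y) w

δheadᶜ : Coeffs Word → Coeffs Word
δheadᶜ f w = ½ * f (y ∷ x ∷ w) - ½ * f (x ∷ y ∷ w) + ¼ * f (y ∷ y ∷ w)

δmidᶜ : Coeffs Word → Coeffs Word
δmidᶜ f []      = 0ℚ
δmidᶜ f (x ∷ w) = δmidᶜ (f · x) w
δmidᶜ f (y ∷ w) = δmidᶜ (f · y) w + (½ * f (y ∷ y ∷ x ∷ w) - ½ * f (x ∷ y ∷ y ∷ w))

δᶜ : Coeffs Word → Coeffs Word
δᶜ f w = δheadᶜ f w + δmidᶜ f w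

shuffle-yᶜ-isLinear : IsLinear shuffle-yᶜ
shuffle-yᶜ-isLinear = record { cong-≗ = cong-≗ ; linear = linear }
  where
  cong-≗ : ∀ {f g} → f ≗ g → shuffle-yᶜ f ≗ shuffle-yᶜ g
  cong-≗ f≗g []      = refl
  cong-≗ f≗g (x ∷ w) = cong-≗ (λ v → f≗g (x ∷ v)) w
  cong-≗ f≗g (y ∷ w) = cong₂ _+_ (cong-≗ (λ v → f≗g (y ∷ v)) w) (f≗g w)
  linear : ∀ c f g → shuffle-yᶜ (λ v → c * f v + g v) ≗ λ w → c * shuffle-yᶜ f w + shuffle-yᶜ g w
  linear c f g []      = linear-0 c
  linear c f g (x ∷ w) = linear c _ _ w
  linear c f g (y ∷ w) = trans (cong (_+ (c * f w + g w)) (linear c _ _ w)) (linear-+ c _ _ (f w) (g w))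

shuffle-xyᶜ-isLinear : IsLinear shuffle-xyᶜ
shuffle-xyᶜ-isLinear = record { cong-≗ = cong-≗ ; linear = linear }
  where
  module Y = IsLinear shuffle-yᶜ-isLinear
  cong-≗ : ∀ {f g} → f ≗ g → shuffle-xyᶜ f ≗ shuffle-xyᶜ g
  cong-≗ f≗g []      = refl
  cong-≗ f≗g (x ∷ w) = cong₂ _+_ (cong-≗ (λ v → f≗g (x ∷ v)) w) (Y.cong-≗ f≗g w)
  cong-≗ f≗g (y ∷ w) = cong-≗ (λ v → f≗g (y ∷ v)) w
  linear : ∀ c f g → shuffle-xyᶜ (λ v → c * f v + g v) ≗ λ w → c * shuffle-xyᶜ f w + shuffle-xyᶜ g w
  linear c f g []      = linear-0 c
  linear c f g (x ∷ w) = trans (cong₂ _+_ (linear c _ _ w) (Y.linear c f g w)) (linear-+ c _ _ _ _)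
  linear c f g (y ∷ w) = linear c _ _ w

δheadᶜ-isLinear : IsLinear δheadᶜ
δheadᶜ-isLinear = record
  { cong-≗ = λ f≗g w → cong₂ _+_ (cong₂ (λ a b → ½ * a - ½ * b) (f≗g _) (f≗g _)) (cong (¼ *_) (f≗g _))
  ; linear = λ c f g w → solve 7 (λ c f₁ g₁ f₂ g₂ f₃ g₃ →
       con ½ :* (c :* f₁ :+ g₁) :- con ½ :* (c :* f₂ :+ g₂) :+ con ¼ :* (c :* f₃ :+ g₃)
       := c :* (con ½ :* f₁ :- con ½ :* f₂ :+ con ¼ :* f₃) :+ (con ½ :* g₁ :- con ½ :* g₂ :+ con ¼ :* g₃))
       refl c _ _ _ _ _ _
  }

δmidᶜ-isLinear : IsLinear δmidᶜ
δmidᶜ-isLinear = record { cong-≗ = cong-≗ ; linear = linear }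
  where
  cong-≗ : ∀ {f g} → f ≗ g → δmidᶜ f ≗ δmidᶜ g
  cong-≗ f≗g []      = refl
  cong-≗ f≗g (x ∷ w) = cong-≗ (λ v → f≗g (x ∷ v)) w
  cong-≗ f≗g (y ∷ w) = cong₂ _+_ (cong-≗ (λ v → f≗g (y ∷ v)) w) (cong₂ (λ a b → ½ * a - ½ * b) (f≗g _) (f≗g _))
  linear : ∀ c f g → δmidᶜ (λ v → c * f v + g v) ≗ λ w → c * δmidᶜ f w + δmidᶜ g w
  linear c f g []      = linear-0 c
  linear c f g (x ∷ w) = linear c _ _ w
  linear c f g (y ∷ w) = trans (cong₂ _+_ (linear c _ _ w) refl) (solve 7 (λ c a b f₁ g₁ f₂ g₂ →
      c :* a :+ b :+ (con ½ :* (c :* f₁ :+ g₁) :- con ½ :* (c :* f₂ :+ g₂))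
      := c :* (a :+ (con ½ :* f₁ :- con ½ :* f₂)) :+ (b :+ (con ½ :* g₁ :- con ½ :* g₂)))
      refl c (δmidᶜ (f · y) w) (δmidᶜ (g · y) w)
      (f (y ∷ y ∷ x ∷ w)) (g (y ∷ y ∷ x ∷ w)) (f (x ∷ y ∷ y ∷ w)) (g (x ∷ y ∷ y ∷ w)))

δᶜ-isLinear : IsLinear δᶜ
δᶜ-isLinear = record
  { cong-≗ = λ f≗g w → cong₂ _+_ (H.cong-≗ f≗g w) (M.cong-≗ f≗g w)
  ; linear = λ c f g w → trans (cong₂ _+_ (H.linear c f g w) (M.linear c f g w)) (linear-+ c _ _ _ _)
  }
  where
  module H = IsLinear δheadᶜ-isLinear
  module M = IsLinear δmidᶜ-isLinear

module Y = IsLinear shuffle-yᶜ-isLinear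
module XY = IsLinear shuffle-xyᶜ-isLinear
module Δmid = IsLinear δmidᶜ-isLinear
module Δ = IsLinear δᶜ-isLinear

shuffle-yᶜ-supported : ∀ {f} → SupportedOnH¹ f → SupportedOnH¹ (shuffle-yᶜ f)
shuffle-yᶜ-supported f-supp here = refl
shuffle-yᶜ-supported f-supp {x ∷ w} (there e) = shuffle-yᶜ-supported (supportedOnH¹-∷ x f-supp) e
shuffle-yᶜ-supported f-supp {y ∷ w} (there e) =
  cong₂ _+_ (shuffle-yᶜ-supported (supportedOnH¹-∷ y f-supp) e) (f-supp e)

shuffle-xyᶜ-supported : ∀ {f} → SupportedOnH¹ f → SupportedOnH¹ (shuffle-xyᶜ f)
shuffle-xyᶜ-supported f-supp here = refl
shuffle-xyᶜ-supported f-supp {x ∷ w} (there e) =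
  cong₂ _+_ (shuffle-xyᶜ-supported (supportedOnH¹-∷ x f-supp) e) (shuffle-yᶜ-supported f-supp e)
shuffle-xyᶜ-supported f-supp {y ∷ w} (there e) = shuffle-xyᶜ-supported (supportedOnH¹-∷ y f-supp) e

δᶜ-supported : ∀ {f} → SupportedOnH¹ f → SupportedOnH¹ (δᶜ f)
δᶜ-supported f-supp e = cong₂ _+_ (head f-supp e) (mid f-supp e)
  where
  head : ∀ {f} → SupportedOnH¹ f → SupportedOnH¹ (δheadᶜ f)
  head f-supp e = cong₂ _+_ (cong₂ (λ a b → ½ * a - ½ * b) (f-supp (there (there e))) (f-supp (there (there e))))
                            (cong (¼ *_) (f-supp (there (there e))))
  mid : ∀ {f} → SupportedOnH¹ f → SupportedOnH¹ (δmidᶜ f)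
  mid f-supp here = refl
  mid f-supp {x ∷ w} (there e) = mid (supportedOnH¹-∷ x f-supp) e
  mid f-supp {y ∷ w} (there e) = cong₂ _+_ (mid (supportedOnH¹-∷ y f-supp) e)
    (cong₂ (λ a b → ½ * a - ½ * b) (f-supp (there (there (there e)))) (f-supp (there (there (there e)))))

shuffle-yᶜ-∷ : ∀ f b w → shuffle-yᶜ f (b ∷ w) ≡ shuffle-yᶜ (f · b) w + 𝟙ℒ y b * f w
shuffle-yᶜ-∷ f x w = sym (trans (cong (shuffle-yᶜ (f · x) w +_) (ℚ.*-zeroˡ (f w))) (ℚ.+-identityʳ _))
shuffle-yᶜ-∷ f y w = cong (shuffle-yᶜ (f · y) w +_) (sym (ℚ.*-identityˡ (f w)))

shuffle-xyᶜ-∷ : ∀ f b w → shuffle-xyᶜ f (b ∷ w) ≡ shuffle-xyᶜ (f · b) w + 𝟙ℒ x b * shuffle-yᶜ f w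
shuffle-xyᶜ-∷ f x w = cong (shuffle-xyᶜ (f · x) w +_) (sym (ℚ.*-identityˡ (shuffle-yᶜ f w)))
shuffle-xyᶜ-∷ f y w = sym (trans (cong (shuffle-xyᶜ (f · y) w +_) (ℚ.*-zeroˡ (shuffle-yᶜ f w))) (ℚ.+-identityʳ _))

δmidᶜ-∷ : ∀ f b w → δmidᶜ f (b ∷ w) ≡ δmidᶜ (f · b) w + 𝟙ℒ y b * (½ * f (y ∷ y ∷ x ∷ w) - ½ * f (x ∷ y ∷ y ∷ w))
δmidᶜ-∷ f x w = sym (trans (cong (δmidᶜ (f · x) w +_) (ℚ.*-zeroˡ (½ * f (y ∷ y ∷ x ∷ w) - ½ * f (x ∷ y ∷ y ∷ w))))
                           (ℚ.+-identityʳ _))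
δmidᶜ-∷ f y w = cong (δmidᶜ (f · y) w +_) (sym (ℚ.*-identityˡ (½ * f (y ∷ y ∷ x ∷ w) - ½ * f (x ∷ y ∷ y ∷ w))))

lengthℚ : Word → ℚ
lengthℚ []      = 0ℚ
lengthℚ (_ ∷ w) = 1ℚ + lengthℚ w

δmidᶜ-shuffle-yᶜ : ∀ {f} → SupportedOnH¹ f → ∀ w → δmidᶜ (shuffle-yᶜ f) w ≡ shuffle-yᶜ (δmidᶜ f) w - f (x ∷ w)
δmidᶜ-shuffle-yᶜ f-supp []      = sym (cong (λ a → 0ℚ - a) (f-supp here))
δmidᶜ-shuffle-yᶜ f-supp (x ∷ w) = δmidᶜ-shuffle-yᶜ (supportedOnH¹-∷ x f-supp) w
δmidᶜ-shuffle-yᶜ {f} f-supp (y ∷ w) = begin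
  δmidᶜ (λ v → shuffle-yᶜ (f · y) v + f v) w + (½ * (B + P + P) - ½ * (C + Q + Q))
    ≡⟨ cong (_+ (½ * (B + P + P) - ½ * (C + Q + Q))) (Δmid.+-homo (shuffle-yᶜ (f · y)) f w) ⟩
  δmidᶜ (shuffle-yᶜ (f · y)) w + M + (½ * (B + P + P) - ½ * (C + Q + Q))
    ≡⟨ cong (λ a → a + M + (½ * (B + P + P) - ½ * (C + Q + Q))) (δmidᶜ-shuffle-yᶜ (supportedOnH¹-∷ y f-supp) w) ⟩
  A - P + M + (½ * (B + P + P) - ½ * (C + Q + Q))
    ≡⟨ solve 6 (λ A P M B C Q → A :- P :+ M :+ (con ½ :* (B :+ P :+ P) :- con ½ :* (C :+ Q :+ Q))
                              := A :+ (con ½ :* B :- con ½ :* C) :+ M :- Q) refl A P M B C Q ⟩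
  A + (½ * B - ½ * C) + M - Q
    ≡⟨ cong (λ a → a + M - Q) (trans (Y.+-homo _ _ w) (cong (A +_) (Y.*-sub-homo ½ _ ½ _ w))) ⟨
  shuffle-yᶜ (λ v → δmidᶜ (f · y) v + (½ * f (y ∷ y ∷ x ∷ v) - ½ * f (x ∷ y ∷ y ∷ v))) w + M - Q ∎
  where
  A B C M P Q : ℚ
  A = shuffle-yᶜ (δmidᶜ (f · y)) w
  B = shuffle-yᶜ (f · y · y · x) w
  C = shuffle-yᶜ (f · x · y · y) w
  M = δmidᶜ f w
  P = f (y ∷ x ∷ w)
  Q = f (x ∷ y ∷ w)

δmidᶜ-shuffle-xyᶜ : ∀ {f} → SupportedOnH¹ f → ∀ w →
  δmidᶜ (shuffle-xyᶜ f) w ≡ shuffle-xyᶜ (δmidᶜ f) w - lengthℚ w * f w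
δmidᶜ-shuffle-xyᶜ {f} f-supp [] = solve 1 (λ a → con 0ℚ := con 0ℚ :- con 0ℚ :* a) refl (f [])
δmidᶜ-shuffle-xyᶜ {f} f-supp (x ∷ w) = begin
  δmidᶜ (λ v → shuffle-xyᶜ (f · x) v + shuffle-yᶜ f v) w
    ≡⟨ Δmid.+-homo (shuffle-xyᶜ (f · x)) (shuffle-yᶜ f) w ⟩
  δmidᶜ (shuffle-xyᶜ (f · x)) w + δmidᶜ (shuffle-yᶜ f) w
    ≡⟨ cong₂ _+_ (δmidᶜ-shuffle-xyᶜ (supportedOnH¹-∷ x f-supp) w) (δmidᶜ-shuffle-yᶜ f-supp w) ⟩
  A - lengthℚ w * F + (B - F)
    ≡⟨ solve 4 (λ A l F B → A :- l :* F :+ (B :- F) := A :+ B :- (con 1ℚ :+ l) :* F) refl A (lengthℚ w) F B ⟩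
  A + B - (1ℚ + lengthℚ w) * F ∎
  where
  A B F : ℚ
  A = shuffle-xyᶜ (δmidᶜ (f · x)) w
  B = shuffle-yᶜ (δmidᶜ f) w
  F = f (x ∷ w)
δmidᶜ-shuffle-xyᶜ {f} f-supp (y ∷ w) = begin
  δmidᶜ (shuffle-xyᶜ (f · y)) w + (½ * (B + S) - ½ * (C + (S + F + F)))
    ≡⟨ cong (_+ (½ * (B + S) - ½ * (C + (S + F + F)))) (δmidᶜ-shuffle-xyᶜ (supportedOnH¹-∷ y f-supp) w) ⟩
  A - lengthℚ w * F + (½ * (B + S) - ½ * (C + (S + F + F)))
    ≡⟨ solve 6 (λ A l F B C S → A :- l :* F :+ (con ½ :* (B :+ S) :- con ½ :* (C :+ (S :+ F :+ F)))
                              := A :+ (con ½ :* B :- con ½ :* C) :- (con 1ℚ :+ l) :* F) refl A (lengthℚ w) F B C S ⟩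
  A + (½ * B - ½ * C) - (1ℚ + lengthℚ w) * F
    ≡⟨ cong (λ a → a - (1ℚ + lengthℚ w) * F) (trans (XY.+-homo _ _ w) (cong (A +_) (XY.*-sub-homo ½ _ ½ _ w))) ⟨
  shuffle-xyᶜ (λ v → δmidᶜ (f · y) v + (½ * f (y ∷ y ∷ x ∷ v) - ½ * f (x ∷ y ∷ y ∷ v))) w - (1ℚ + lengthℚ w) * F ∎
  where
  A B C S F : ℚ
  A = shuffle-xyᶜ (δmidᶜ (f · y)) w
  B = shuffle-xyᶜ (f · y · y · x) w
  C = shuffle-xyᶜ (f · x · y · y) w
  S = shuffle-yᶜ (f · y · y) w
  F = f (y ∷ w)

δheadᶜ-shuffle-xyᶜ : ∀ f w → δheadᶜ (shuffle-xyᶜ f) w ≡ shuffle-xyᶜ (δheadᶜ f) w - ½ * f w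
δheadᶜ-shuffle-xyᶜ f w = begin
  ½ * (A + S) - ½ * (B + (S + F)) + ¼ * C
    ≡⟨ solve 5 (λ A B C S F → con ½ :* (A :+ S) :- con ½ :* (B :+ (S :+ F)) :+ con ¼ :* C
                            := con ½ :* A :- con ½ :* B :+ con ¼ :* C :- con ½ :* F) refl A B C S F ⟩
  ½ * A - ½ * B + ¼ * C - ½ * F
    ≡⟨ cong (λ a → a - ½ * F) (trans (XY.+-homo _ _ w) (cong₂ _+_ (XY.*-sub-homo ½ _ ½ _ w) (XY.*-homo ¼ _ w))) ⟨
  shuffle-xyᶜ (δheadᶜ f) w - ½ * F ∎
  where
  A B C S F : ℚ
  A = shuffle-xyᶜ (f · y · x) w
  B = shuffle-xyᶜ (f · x · y) w
  C = shuffle-xyᶜ (f · y · y) w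
  S = shuffle-yᶜ (f · y) w
  F = f w

δᶜ-shuffle-xyᶜ : ∀ {f} → SupportedOnH¹ f → ∀ w →
  δᶜ (shuffle-xyᶜ f) w ≡ shuffle-xyᶜ (δᶜ f) w - ½ * f w - lengthℚ w * f w
δᶜ-shuffle-xyᶜ {f} f-supp w = begin
  δheadᶜ (shuffle-xyᶜ f) w + δmidᶜ (shuffle-xyᶜ f) w
    ≡⟨ cong₂ _+_ (δheadᶜ-shuffle-xyᶜ f w) (δmidᶜ-shuffle-xyᶜ f-supp w) ⟩
  shuffle-xyᶜ (δheadᶜ f) w - ½ * f w + (shuffle-xyᶜ (δmidᶜ f) w - lengthℚ w * f w)
    ≡⟨ solve 4 (λ H F M l → H :- con ½ :* F :+ (M :- l :* F) := H :+ M :- con ½ :* F :- l :* F) refl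
         (shuffle-xyᶜ (δheadᶜ f) w) (f w) (shuffle-xyᶜ (δmidᶜ f) w) (lengthℚ w) ⟩
  shuffle-xyᶜ (δheadᶜ f) w + shuffle-xyᶜ (δmidᶜ f) w - ½ * f w - lengthℚ w * f w
    ≡⟨ cong (λ a → a - ½ * f w - lengthℚ w * f w) (XY.+-homo (δheadᶜ f) (δmidᶜ f) w) ⟨
  shuffle-xyᶜ (δᶜ f) w - ½ * f w - lengthℚ w * f w ∎

coeff-shuffle-y : ∀ u → coeff (units (shW u (y ∷ []))) ≗ shuffle-yᶜ (𝟙 u)
coeff-shuffle-y []      []      = refl
coeff-shuffle-y []      (b ∷ w) = begin
  𝟙 (y ∷ []) (b ∷ w)                          ≡⟨ 𝟙-∷-∷ y b [] w ⟩
  𝟙ℒ y b * 𝟙 [] w                             ≡⟨ ℚ.+-identityˡ _ ⟨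
  0ℚ + 𝟙ℒ y b * 𝟙 [] w                        ≡⟨ cong (_+ 𝟙ℒ y b * 𝟙 [] w) (Y.0-homo w) ⟨
  shuffle-yᶜ (𝟙 [] · b) w + 𝟙ℒ y b * 𝟙 [] w    ≡⟨ shuffle-yᶜ-∷ (𝟙 []) b w ⟨
  shuffle-yᶜ (𝟙 []) (b ∷ w)                   ∎
coeff-shuffle-y (a ∷ u) []      = trans (coeff-units-++ (map (a ∷_) (shW u (y ∷ []))) ((y ∷ a ∷ u) ∷ []) [])
  (cong (_+ 𝟙 (y ∷ a ∷ u) []) (coeff-units-map-∷-[] a (shW u (y ∷ []))))
coeff-shuffle-y (a ∷ u) (b ∷ w) = begin
  coeff (units (map (a ∷_) (shW u (y ∷ [])) ++ (y ∷ a ∷ u) ∷ [])) (b ∷ w)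
    ≡⟨ coeff-units-++ (map (a ∷_) (shW u (y ∷ []))) ((y ∷ a ∷ u) ∷ []) (b ∷ w) ⟩
  coeff (units (map (a ∷_) (shW u (y ∷ [])))) (b ∷ w) + 𝟙 (y ∷ a ∷ u) (b ∷ w)
    ≡⟨ cong₂ _+_ (coeff-units-map-∷ a (shW u (y ∷ [])) b w) (𝟙-∷-∷ y b (a ∷ u) w) ⟩
  𝟙ℒ a b * coeff (units (shW u (y ∷ []))) w + 𝟙ℒ y b * 𝟙 (a ∷ u) w
    ≡⟨ cong (λ s → 𝟙ℒ a b * s + 𝟙ℒ y b * 𝟙 (a ∷ u) w) (coeff-shuffle-y u w) ⟩
  𝟙ℒ a b * shuffle-yᶜ (𝟙 u) w + 𝟙ℒ y b * 𝟙 (a ∷ u) w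
    ≡⟨ cong (_+ 𝟙ℒ y b * 𝟙 (a ∷ u) w) (𝟙-∷-isLinear shuffle-yᶜ-isLinear a u b w) ⟨
  shuffle-yᶜ (𝟙 (a ∷ u) · b) w + 𝟙ℒ y b * 𝟙 (a ∷ u) w
    ≡⟨ shuffle-yᶜ-∷ (𝟙 (a ∷ u)) b w ⟨
  shuffle-yᶜ (𝟙 (a ∷ u)) (b ∷ w) ∎

coeff-shuffle-xy : ∀ u → coeff (units (shW u (x ∷ y ∷ []))) ≗ shuffle-xyᶜ (𝟙 u)
coeff-shuffle-xy []      []      = refl
coeff-shuffle-xy []      (b ∷ w) = begin
  𝟙 (x ∷ y ∷ []) (b ∷ w)                                  ≡⟨ 𝟙-∷-∷ x b (y ∷ []) w ⟩
  𝟙ℒ x b * 𝟙 (y ∷ []) w                                   ≡⟨ cong (𝟙ℒ x b *_) (coeff-shuffle-y [] w) ⟩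
  𝟙ℒ x b * shuffle-yᶜ (𝟙 []) w                             ≡⟨ ℚ.+-identityˡ _ ⟨
  0ℚ + 𝟙ℒ x b * shuffle-yᶜ (𝟙 []) w                        ≡⟨ cong (_+ 𝟙ℒ x b * shuffle-yᶜ (𝟙 []) w) (XY.0-homo w) ⟨
  shuffle-xyᶜ (𝟙 [] · b) w + 𝟙ℒ x b * shuffle-yᶜ (𝟙 []) w   ≡⟨ shuffle-xyᶜ-∷ (𝟙 []) b w ⟨
  shuffle-xyᶜ (𝟙 []) (b ∷ w)                               ∎
coeff-shuffle-xy (a ∷ u) []      = trans (coeff-units-++ (map (a ∷_) (shW u (x ∷ y ∷ []))) _ [])
  (cong₂ _+_ (coeff-units-map-∷-[] a (shW u (x ∷ y ∷ []))) (coeff-units-map-∷-[] x (shW (a ∷ u) (y ∷ []))))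
coeff-shuffle-xy (a ∷ u) (b ∷ w) = begin
  coeff (units (map (a ∷_) (shW u (x ∷ y ∷ [])) ++ map (x ∷_) (shW (a ∷ u) (y ∷ [])))) (b ∷ w)
    ≡⟨ coeff-units-++ (map (a ∷_) (shW u (x ∷ y ∷ []))) (map (x ∷_) (shW (a ∷ u) (y ∷ []))) (b ∷ w) ⟩
  coeff (units (map (a ∷_) (shW u (x ∷ y ∷ [])))) (b ∷ w) + coeff (units (map (x ∷_) (shW (a ∷ u) (y ∷ [])))) (b ∷ w)
    ≡⟨ cong₂ _+_ (coeff-units-map-∷ a (shW u (x ∷ y ∷ [])) b w) (coeff-units-map-∷ x (shW (a ∷ u) (y ∷ [])) b w) ⟩
  𝟙ℒ a b * coeff (units (shW u (x ∷ y ∷ []))) w + 𝟙ℒ x b * coeff (units (shW (a ∷ u) (y ∷ []))) w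
    ≡⟨ cong₂ (λ s t → 𝟙ℒ a b * s + 𝟙ℒ x b * t) (coeff-shuffle-xy u w) (coeff-shuffle-y (a ∷ u) w) ⟩
  𝟙ℒ a b * shuffle-xyᶜ (𝟙 u) w + 𝟙ℒ x b * shuffle-yᶜ (𝟙 (a ∷ u)) w
    ≡⟨ cong (_+ 𝟙ℒ x b * shuffle-yᶜ (𝟙 (a ∷ u)) w) (𝟙-∷-isLinear shuffle-xyᶜ-isLinear a u b w) ⟨
  shuffle-xyᶜ (𝟙 (a ∷ u) · b) w + 𝟙ℒ x b * shuffle-yᶜ (𝟙 (a ∷ u)) w
    ≡⟨ shuffle-xyᶜ-∷ (𝟙 (a ∷ u)) b w ⟨
  shuffle-xyᶜ (𝟙 (a ∷ u)) (b ∷ w) ∎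

coeff-⧢z₂ : ∀ p → coeff (p ⧢ z₂) ≗ shuffle-xyᶜ (coeff p)
coeff-⧢z₂ = coeff-concatMap _ shuffle-xyᶜ-isLinear λ c u w → begin
  coeff (scale (c * 1ℚ) (units (shW u (x ∷ y ∷ []))) ++ []) w
    ≡⟨ trans (coeff-++ (scale (c * 1ℚ) (units (shW u (x ∷ y ∷ [])))) [] w) (ℚ.+-identityʳ _) ⟩
  coeff (scale (c * 1ℚ) (units (shW u (x ∷ y ∷ [])))) w
    ≡⟨ coeff-scale (c * 1ℚ) (units (shW u (x ∷ y ∷ []))) w ⟩
  c * 1ℚ * coeff (units (shW u (x ∷ y ∷ []))) w
    ≡⟨ cong₂ _*_ (ℚ.*-identityʳ c) (coeff-shuffle-xy u w) ⟩
  c * shuffle-xyᶜ (𝟙 u) w ∎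

coeff-δhead : ∀ v → coeff (δhead v) ≗ δheadᶜ (𝟙 v)
coeff-δhead []              w = refl
coeff-δhead (x ∷ [])        w = refl
coeff-δhead (y ∷ [])        w = refl
coeff-δhead (x ∷ x ∷ u)     w = refl
coeff-δhead (x ∷ y ∷ u)     w = begin
  coeff ((-½ , u) ∷ []) w                      ≡⟨ coeff-single -½ u w ⟩
  -½ * 𝟙 u w
    ≡⟨ solve 1 (λ a → :- con ½ :* a := con ½ :* con 0ℚ :- con ½ :* a :+ con ¼ :* con 0ℚ) refl (𝟙 u w) ⟩
  ½ * 0ℚ - ½ * 𝟙 u w + ¼ * 0ℚ                  ≡⟨ cong (λ a → ½ * 0ℚ - ½ * a + ¼ * 0ℚ) (𝟙-++ (x ∷ y ∷ []) u w) ⟨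
  δheadᶜ (𝟙 (x ∷ y ∷ u)) w                     ∎
coeff-δhead (y ∷ x ∷ u)     w = begin
  coeff ((½ , u) ∷ []) w                       ≡⟨ coeff-single ½ u w ⟩
  ½ * 𝟙 u w
    ≡⟨ solve 1 (λ a → con ½ :* a := con ½ :* a :- con ½ :* con 0ℚ :+ con ¼ :* con 0ℚ) refl (𝟙 u w) ⟩
  ½ * 𝟙 u w - ½ * 0ℚ + ¼ * 0ℚ                  ≡⟨ cong (λ a → ½ * a - ½ * 0ℚ + ¼ * 0ℚ) (𝟙-++ (y ∷ x ∷ []) u w) ⟨
  δheadᶜ (𝟙 (y ∷ x ∷ u)) w                     ∎
coeff-δhead (y ∷ y ∷ u)     w = begin
  coeff ((¼ , u) ∷ []) w                       ≡⟨ coeff-single ¼ u w ⟩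
  ¼ * 𝟙 u w
    ≡⟨ solve 1 (λ a → con ¼ :* a := con ½ :* con 0ℚ :- con ½ :* con 0ℚ :+ con ¼ :* a) refl (𝟙 u w) ⟩
  ½ * 0ℚ - ½ * 0ℚ + ¼ * 𝟙 u w                  ≡⟨ cong (λ a → ½ * 0ℚ - ½ * 0ℚ + ¼ * a) (𝟙-++ (y ∷ y ∷ []) u w) ⟨
  δheadᶜ (𝟙 (y ∷ y ∷ u)) w                     ∎

δmid-tail : Word → Poly
δmid-tail (y ∷ y ∷ x ∷ u) = (½ , u) ∷ []
δmid-tail (x ∷ y ∷ y ∷ u) = (-½ , u) ∷ []
δmid-tail _               = []

δmid-shape : ∀ u v → δmid u v ≡ map (λ (c , v′) → (c , u ++ y ∷ v′)) (δmid-tail v)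
δmid-shape u []              = refl
δmid-shape u (x ∷ [])        = refl
δmid-shape u (y ∷ [])        = refl
δmid-shape u (x ∷ x ∷ v)     = refl
δmid-shape u (x ∷ y ∷ [])    = refl
δmid-shape u (x ∷ y ∷ x ∷ v) = refl
δmid-shape u (x ∷ y ∷ y ∷ v) = refl
δmid-shape u (y ∷ x ∷ v)     = refl
δmid-shape u (y ∷ y ∷ [])    = refl
δmid-shape u (y ∷ y ∷ x ∷ v) = refl
δmid-shape u (y ∷ y ∷ y ∷ v) = refl

coeff-δmid-tail : ∀ v w → coeff (δmid-tail v) w ≡ ½ * 𝟙 v (y ∷ y ∷ x ∷ w) - ½ * 𝟙 v (x ∷ y ∷ y ∷ w)
coeff-δmid-tail []              w = refl
coeff-δmid-tail (x ∷ [])        w = refl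
coeff-δmid-tail (y ∷ [])        w = refl
coeff-δmid-tail (x ∷ x ∷ v)     w = refl
coeff-δmid-tail (x ∷ y ∷ [])    w = refl
coeff-δmid-tail (x ∷ y ∷ x ∷ v) w = refl
coeff-δmid-tail (y ∷ x ∷ v)     w = refl
coeff-δmid-tail (y ∷ y ∷ [])    w = refl
coeff-δmid-tail (y ∷ y ∷ y ∷ v) w = refl
coeff-δmid-tail (y ∷ y ∷ x ∷ v) w = begin
  coeff ((½ , v) ∷ []) w                ≡⟨ coeff-single ½ v w ⟩
  ½ * 𝟙 v w                             ≡⟨ solve 1 (λ a → con ½ :* a := con ½ :* a :- con ½ :* con 0ℚ) refl (𝟙 v w) ⟩
  ½ * 𝟙 v w - ½ * 0ℚ                    ≡⟨ cong (λ a → ½ * a - ½ * 0ℚ) (𝟙-++ (y ∷ y ∷ x ∷ []) v w) ⟨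
  ½ * 𝟙 (y ∷ y ∷ x ∷ v) (y ∷ y ∷ x ∷ w) - ½ * 0ℚ ∎
coeff-δmid-tail (x ∷ y ∷ y ∷ v) w = begin
  coeff ((-½ , v) ∷ []) w               ≡⟨ coeff-single -½ v w ⟩
  -½ * 𝟙 v w
    ≡⟨ solve 1 (λ a → :- con ½ :* a := con ½ :* con 0ℚ :- con ½ :* a) refl (𝟙 v w) ⟩
  ½ * 0ℚ - ½ * 𝟙 v w                    ≡⟨ cong (λ a → ½ * 0ℚ - ½ * a) (𝟙-++ (x ∷ y ∷ y ∷ []) v w) ⟨
  ½ * 0ℚ - ½ * 𝟙 (x ∷ y ∷ y ∷ v) (x ∷ y ∷ y ∷ w) ∎

δmidΣ : Word → Poly
δmidΣ v = concatMap (λ (u , v′) → δmid u v′) (splits v)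

δmidΣ-∷ : ∀ l v → δmidΣ (l ∷ v) ≡ prefix y (δmid-tail (l ∷ v)) ++ prefix l (δmidΣ v)
δmidΣ-∷ l v = cong₂ _++_ (δmid-shape [] (l ∷ v)) (begin
  concatMap (λ (u , v′) → δmid u v′) (map (λ (u , v′) → (l ∷ u , v′)) (splits v))
    ≡⟨ List.concatMap-map (λ (u , v′) → δmid u v′) (λ (u , v′) → (l ∷ u , v′)) (splits v) ⟩
  concatMap (λ (u , v′) → δmid (l ∷ u) v′) (splits v)
    ≡⟨ List.concatMap-cong (λ (u , v′) → trans (δmid-shape (l ∷ u) v′)
         (trans (List.map-∘ (δmid-tail v′)) (cong (prefix l) (sym (δmid-shape u v′))))) (splits v) ⟩
  concatMap (λ (u , v′) → prefix l (δmid u v′)) (splits v)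
    ≡⟨ List.map-concatMap (λ (c , v′) → (c , l ∷ v′)) (λ (u , v′) → δmid u v′) (splits v) ⟨
  prefix l (δmidΣ v) ∎)

coeff-δmidΣ : ∀ v → coeff (δmidΣ v) ≗ δmidᶜ (𝟙 v)
coeff-δmidΣ []      []      = refl
coeff-δmidΣ []      (x ∷ w) = sym (Δmid.0-homo w)
coeff-δmidΣ []      (y ∷ w) = sym (cong (_+ (½ * 0ℚ - ½ * 0ℚ)) (Δmid.0-homo w))
coeff-δmidΣ (l ∷ v) w = trans (cong (λ p → coeff p w) (δmidΣ-∷ l v))
  (trans (coeff-++ (prefix y (δmid-tail (l ∷ v))) (prefix l (δmidΣ v)) w) (by-letter w))
  where
  by-letter : ∀ w → coeff (prefix y (δmid-tail (l ∷ v))) w + coeff (prefix l (δmidΣ v)) w ≡ δmidᶜ (𝟙 (l ∷ v)) w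
  by-letter []      = cong₂ _+_ (coeff-prefix-[] y (δmid-tail (l ∷ v))) (coeff-prefix-[] l (δmidΣ v))
  by-letter (b ∷ w) = begin
    coeff (prefix y (δmid-tail (l ∷ v))) (b ∷ w) + coeff (prefix l (δmidΣ v)) (b ∷ w)
      ≡⟨ cong₂ _+_ (coeff-prefix y (δmid-tail (l ∷ v)) b w) (coeff-prefix l (δmidΣ v) b w) ⟩
    𝟙ℒ y b * coeff (δmid-tail (l ∷ v)) w + 𝟙ℒ l b * coeff (δmidΣ v) w
      ≡⟨ cong₂ (λ p q → 𝟙ℒ y b * p + 𝟙ℒ l b * q) (coeff-δmid-tail (l ∷ v) w) (coeff-δmidΣ v w) ⟩
    𝟙ℒ y b * Y₁ + 𝟙ℒ l b * δmidᶜ (𝟙 v) w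
      ≡⟨ ℚ.+-comm (𝟙ℒ y b * Y₁) (𝟙ℒ l b * δmidᶜ (𝟙 v) w) ⟩
    𝟙ℒ l b * δmidᶜ (𝟙 v) w + 𝟙ℒ y b * Y₁
      ≡⟨ cong (_+ 𝟙ℒ y b * Y₁) (𝟙-∷-isLinear δmidᶜ-isLinear l v b w) ⟨
    δmidᶜ (𝟙 (l ∷ v) · b) w + 𝟙ℒ y b * Y₁
      ≡⟨ δmidᶜ-∷ (𝟙 (l ∷ v)) b w ⟨
    δmidᶜ (𝟙 (l ∷ v)) (b ∷ w) ∎
    where
    Y₁ : ℚ
    Y₁ = ½ * 𝟙 (l ∷ v) (y ∷ y ∷ x ∷ w) - ½ * 𝟙 (l ∷ v) (x ∷ y ∷ y ∷ w)

coeff-δW : ∀ v → coeff (δW v) ≗ δᶜ (𝟙 v)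
coeff-δW v w = trans (coeff-++ (δhead v) (δmidΣ v) w) (cong₂ _+_ (coeff-δhead v w) (coeff-δmidΣ v w))

coeff-δ : ∀ p → coeff (δ p) ≗ δᶜ (coeff p)
coeff-δ = coeff-lin δW δᶜ-isLinear coeff-δW

-- The quasi-shuffle product on z-words

-- A z-word k₁ ⋯ kₙ stands for z_{k₁+1} ⋯ z_{kₙ+1}; the shift makes it a bijective
-- encoding of H¹-words.
ZWord : Set
ZWord = List ℕ

infixl 7 _✱ᶻ_

mutual
  _✱ᶻ_ : Coeffs ZWord → Coeffs ZWord → Coeffs ZWord
  (f ✱ᶻ g) []      = f [] * g []
  (f ✱ᶻ g) (k ∷ t) = ((f · k) ✱ᶻ g) t + (f ✱ᶻ (g · k)) t
                   + merged (f ·_) (g ·_) t k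

  -- Σ_{i + j + 1 = k} (F i ✱ᶻ G j) t: the first letters z_{i+1} and z_{j+1} merge into z_{k+1}
  merged : (ℕ → Coeffs ZWord) → (ℕ → Coeffs ZWord) → ZWord → ℕ → ℚ
  merged F G t zero    = 0ℚ
  merged F G t (suc k) = (F 0 ✱ᶻ G k) t + merged (λ i → F (suc i)) G t k

mutual
  ✱ᶻ-cong : ∀ {f f′ g g′} → f ≗ f′ → g ≗ g′ → f ✱ᶻ g ≗ f′ ✱ᶻ g′
  ✱ᶻ-cong f≗ g≗ []      = cong₂ _*_ (f≗ []) (g≗ [])
  ✱ᶻ-cong f≗ g≗ (k ∷ t) =
    cong₂ _+_ (cong₂ _+_ (✱ᶻ-cong (λ s → f≗ (k ∷ s)) g≗ t) (✱ᶻ-cong f≗ (λ s → g≗ (k ∷ s)) t))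
              (merged-cong (λ i s → f≗ (i ∷ s)) (λ j s → g≗ (j ∷ s)) t k)

  merged-cong : ∀ {F F′ G G′} → (∀ i → F i ≗ F′ i) → (∀ j → G j ≗ G′ j) → ∀ t k →
    merged F G t k ≡ merged F′ G′ t k
  merged-cong F≗ G≗ t zero    = refl
  merged-cong F≗ G≗ t (suc k) = cong₂ _+_ (✱ᶻ-cong (F≗ 0) (G≗ k) t) (merged-cong (λ i → F≗ (suc i)) G≗ t k)

mutual
  ✱ᶻ-linearˡ : ∀ c f f′ g → (λ s → c * f s + f′ s) ✱ᶻ g ≗ λ t → c * (f ✱ᶻ g) t + (f′ ✱ᶻ g) t
  ✱ᶻ-linearˡ c f f′ g []      = solve 4 (λ c a b d → (c :* a :+ b) :* d := c :* (a :* d) :+ b :* d) refl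
                                  c (f []) (f′ []) (g [])
  ✱ᶻ-linearˡ c f f′ g (k ∷ t) =
    trans (cong₂ _+_ (cong₂ _+_ (✱ᶻ-linearˡ c _ _ g t) (✱ᶻ-linearˡ c f f′ _ t)) (merged-linearˡ c _ _ _ t k))
          (linear-+₃ c _ _ _ _ _ _)

  merged-linearˡ : ∀ c F F′ G t k →
    merged (λ i s → c * F i s + F′ i s) G t k ≡ c * merged F G t k + merged F′ G t k
  merged-linearˡ c F F′ G t zero    = linear-0 c
  merged-linearˡ c F F′ G t (suc k) =
    trans (cong₂ _+_ (✱ᶻ-linearˡ c (F 0) (F′ 0) (G k) t) (merged-linearˡ c _ _ G t k)) (linear-+ c _ _ _ _)

mutual
  ✱ᶻ-linearʳ : ∀ c f g g′ → f ✱ᶻ (λ s → c * g s + g′ s) ≗ λ t → c * (f ✱ᶻ g) t + (f ✱ᶻ g′) t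
  ✱ᶻ-linearʳ c f g g′ []      = solve 4 (λ c a b d → d :* (c :* a :+ b) := c :* (d :* a) :+ d :* b) refl
                                  c (g []) (g′ []) (f [])
  ✱ᶻ-linearʳ c f g g′ (k ∷ t) =
    trans (cong₂ _+_ (cong₂ _+_ (✱ᶻ-linearʳ c _ g g′ t) (✱ᶻ-linearʳ c f _ _ t)) (merged-linearʳ c _ _ _ t k))
          (linear-+₃ c _ _ _ _ _ _)

  merged-linearʳ : ∀ c F G G′ t k →
    merged F (λ j s → c * G j s + G′ j s) t k ≡ c * merged F G t k + merged F G′ t k
  merged-linearʳ c F G G′ t zero    = linear-0 c
  merged-linearʳ c F G G′ t (suc k) =
    trans (cong₂ _+_ (✱ᶻ-linearʳ c (F 0) (G k) (G′ k) t) (merged-linearʳ c _ G G′ t k)) (linear-+ c _ _ _ _)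

✱ᶻ-isLinearˡ : ∀ g → IsLinear (_✱ᶻ g)
✱ᶻ-isLinearˡ g = record { cong-≗ = λ f≗ → ✱ᶻ-cong f≗ (λ _ → refl) ; linear = λ c f f′ → ✱ᶻ-linearˡ c f f′ g }

✱ᶻ-isLinearʳ : ∀ f → IsLinear (f ✱ᶻ_)
✱ᶻ-isLinearʳ f = record { cong-≗ = ✱ᶻ-cong (λ _ → refl) ; linear = λ c g g′ → ✱ᶻ-linearʳ c f g g′ }

-- merged is uncurried here so that the laws derived in IsLinear apply to it.
merged-isLinearˡ : ∀ G → IsLinear {ℕ × ZWord} {ZWord × ℕ} (λ F (t , k) → merged (curry F) G t k)
merged-isLinearˡ G = record
  { cong-≗ = λ F≗ (t , k) → merged-cong (λ i s → F≗ (i , s)) (λ _ _ → refl) t k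
  ; linear = λ c F F′ (t , k) → merged-linearˡ c (curry F) (curry F′) G t k
  }

merged-isLinearʳ : ∀ F → IsLinear {ℕ × ZWord} {ZWord × ℕ} (λ G (t , k) → merged F (curry G) t k)
merged-isLinearʳ F = record
  { cong-≗ = λ G≗ (t , k) → merged-cong (λ _ _ → refl) (λ j s → G≗ (j , s)) t k
  ; linear = λ c G G′ (t , k) → merged-linearʳ c F (curry G) (curry G′) t k
  }

module ✱ᶻˡ (g : Coeffs ZWord) = IsLinear (✱ᶻ-isLinearˡ g)
module ✱ᶻʳ (f : Coeffs ZWord) = IsLinear (✱ᶻ-isLinearʳ f)
module Mergedˡ (G : ℕ → Coeffs ZWord) = IsLinear (merged-isLinearˡ G)
module Mergedʳ (F : ℕ → Coeffs ZWord) = IsLinear (merged-isLinearʳ F)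

merged-last : ∀ F G t k → merged F G t (suc k) ≡ (F k ✱ᶻ G 0) t + merged F (λ j → G (suc j)) t k
merged-last F G t zero    = refl
merged-last F G t (suc k) = begin
  (F 0 ✱ᶻ G (suc k)) t + merged (λ i → F (suc i)) G t (suc k)
    ≡⟨ cong ((F 0 ✱ᶻ G (suc k)) t +_) (merged-last (λ i → F (suc i)) G t k) ⟩
  (F 0 ✱ᶻ G (suc k)) t + ((F (suc k) ✱ᶻ G 0) t + merged (λ i → F (suc i)) (λ j → G (suc j)) t k)
    ≡⟨ x∙yz≈y∙xz ((F 0 ✱ᶻ G (suc k)) t) ((F (suc k) ✱ᶻ G 0) t) _ ⟩
  (F (suc k) ✱ᶻ G 0) t + ((F 0 ✱ᶻ G (suc k)) t + merged (λ i → F (suc i)) (λ j → G (suc j)) t k) ∎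

merged-0∷ : ∀ F G t k →
  merged F G (0 ∷ t) k ≡ merged (λ i s → F i (0 ∷ s)) G t k + merged F (λ j s → G j (0 ∷ s)) t k
merged-0∷ F G t zero    = refl
merged-0∷ F G t (suc k) = begin
  (F₀ ✱ᶻ G k) t + (F 0 ✱ᶻ G₀) t + 0ℚ + merged (λ i → F (suc i)) G (0 ∷ t) k
    ≡⟨ cong₂ _+_ (ℚ.+-identityʳ ((F₀ ✱ᶻ G k) t + (F 0 ✱ᶻ G₀) t)) (merged-0∷ (λ i → F (suc i)) G t k) ⟩
  (F₀ ✱ᶻ G k) t + (F 0 ✱ᶻ G₀) t
    + (merged (λ i s → F (suc i) (0 ∷ s)) G t k + merged (λ i → F (suc i)) (λ j s → G j (0 ∷ s)) t k)
    ≡⟨ interchange ((F₀ ✱ᶻ G k) t) ((F 0 ✱ᶻ G₀) t) _ _ ⟩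
  (F₀ ✱ᶻ G k) t + merged (λ i s → F (suc i) (0 ∷ s)) G t k
    + ((F 0 ✱ᶻ G₀) t + merged (λ i → F (suc i)) (λ j s → G j (0 ∷ s)) t k) ∎
  where
  F₀ G₀ : Coeffs ZWord
  F₀ s = F 0 (0 ∷ s)
  G₀ s = G k (0 ∷ s)

𝟙ℕ : ℕ → ℕ → ℚ
𝟙ℕ zero    zero    = 1ℚ
𝟙ℕ zero    (suc _) = 0ℚ
𝟙ℕ (suc _) zero    = 0ℚ
𝟙ℕ (suc a) (suc b) = 𝟙ℕ a b

𝟙ᶻ : ZWord → Coeffs ZWord
𝟙ᶻ []      []      = 1ℚ
𝟙ᶻ []      (_ ∷ _) = 0ℚ
𝟙ᶻ (_ ∷ _) []      = 0ℚ
𝟙ᶻ (a ∷ s) (k ∷ t) = 𝟙ℕ a k * 𝟙ᶻ s t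

✱ᶻ-identityʳ : ∀ f → f ✱ᶻ 𝟙ᶻ [] ≗ f
✱ᶻ-identityʳ f []      = ℚ.*-identityʳ (f [])
✱ᶻ-identityʳ f (k ∷ t) = begin
  (f · k ✱ᶻ 𝟙ᶻ []) t + (f ✱ᶻ const 0ℚ) t + merged (f ·_) (λ _ _ → 0ℚ) t k
    ≡⟨ cong₂ _+_ (cong₂ _+_ (✱ᶻ-identityʳ (f · k) t) (✱ᶻʳ.0-homo f t)) (Mergedʳ.0-homo (f ·_) (t , k)) ⟩
  f (k ∷ t) + 0ℚ + 0ℚ
    ≡⟨ trans (ℚ.+-identityʳ _) (ℚ.+-identityʳ _) ⟩
  f (k ∷ t) ∎

merged-𝟙ℕ : ∀ a b P Q t k →
  merged (λ i s → 𝟙ℕ a i * P s) (λ j s → 𝟙ℕ b j * Q s) t k ≡ 𝟙ℕ (a ℕ.+ suc b) k * (P ✱ᶻ Q) t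
merged-𝟙ℕ zero    b P Q t zero    = sym (ℚ.*-zeroˡ ((P ✱ᶻ Q) t))
merged-𝟙ℕ (suc a) b P Q t zero    = sym (ℚ.*-zeroˡ ((P ✱ᶻ Q) t))
merged-𝟙ℕ zero    b P Q t (suc k) = begin
  ((λ s → 1ℚ * P s) ✱ᶻ (λ s → 𝟙ℕ b k * Q s)) t + merged (λ i s → 0ℚ * P s) (λ j s → 𝟙ℕ b j * Q s) t k
    ≡⟨ cong₂ _+_ (✱ᶻ-cong (λ s → ℚ.*-identityˡ (P s)) (λ _ → refl) t)
                 (Mergedˡ.*-homo (λ j s → 𝟙ℕ b j * Q s) 0ℚ (λ (_ , s) → P s) (t , k)) ⟩
  (P ✱ᶻ (λ s → 𝟙ℕ b k * Q s)) t + 0ℚ * merged (λ _ → P) (λ j s → 𝟙ℕ b j * Q s) t k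
    ≡⟨ cong₂ _+_ (✱ᶻʳ.*-homo P (𝟙ℕ b k) Q t) (ℚ.*-zeroˡ (merged (λ _ → P) (λ j s → 𝟙ℕ b j * Q s) t k)) ⟩
  𝟙ℕ b k * (P ✱ᶻ Q) t + 0ℚ
    ≡⟨ ℚ.+-identityʳ _ ⟩
  𝟙ℕ b k * (P ✱ᶻ Q) t ∎
merged-𝟙ℕ (suc a) b P Q t (suc k) = begin
  ((λ s → 0ℚ * P s) ✱ᶻ (λ s → 𝟙ℕ b k * Q s)) t + merged (λ i s → 𝟙ℕ a i * P s) (λ j s → 𝟙ℕ b j * Q s) t k
    ≡⟨ cong₂ _+_ (✱ᶻˡ.*-homo (λ s → 𝟙ℕ b k * Q s) 0ℚ P t) (merged-𝟙ℕ a b P Q t k) ⟩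
  0ℚ * (P ✱ᶻ (λ s → 𝟙ℕ b k * Q s)) t + 𝟙ℕ (a ℕ.+ suc b) k * (P ✱ᶻ Q) t
    ≡⟨ cong (_+ 𝟙ℕ (a ℕ.+ suc b) k * (P ✱ᶻ Q) t) (ℚ.*-zeroˡ ((P ✱ᶻ (λ s → 𝟙ℕ b k * Q s)) t)) ⟩
  0ℚ + 𝟙ℕ (a ℕ.+ suc b) k * (P ✱ᶻ Q) t
    ≡⟨ ℚ.+-identityˡ _ ⟩
  𝟙ℕ (a ℕ.+ suc b) k * (P ✱ᶻ Q) t ∎

qsh₀ : ZWord → ZWord → List ZWord
qsh₀ []      v       = v ∷ []
qsh₀ (a ∷ u) []      = (a ∷ u) ∷ []
qsh₀ (a ∷ u) (b ∷ v) =
  map (a ∷_) (qsh₀ u (b ∷ v)) ++ map (b ∷_) (qsh₀ (a ∷ u) v) ++ map (a ℕ.+ suc b ∷_) (qsh₀ u v)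

qsh₀-identityʳ : ∀ u → qsh₀ u [] ≡ u ∷ []
qsh₀-identityʳ []      = refl
qsh₀-identityʳ (_ ∷ _) = refl

multiplicity : ZWord → List ZWord → ℚ
multiplicity t []      = 0ℚ
multiplicity t (r ∷ L) = 𝟙ᶻ r t + multiplicity t L

multiplicity-++ : ∀ t A B → multiplicity t (A ++ B) ≡ multiplicity t A + multiplicity t B
multiplicity-++ t []      B = sym (ℚ.+-identityˡ (multiplicity t B))
multiplicity-++ t (r ∷ A) B =
  trans (cong (𝟙ᶻ r t +_) (multiplicity-++ t A B)) (sym (ℚ.+-assoc (𝟙ᶻ r t) (multiplicity t A) (multiplicity t B)))

multiplicity-map-∷ : ∀ a k t L → multiplicity (k ∷ t) (map (a ∷_) L) ≡ 𝟙ℕ a k * multiplicity t L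
multiplicity-map-∷ a k t []      = sym (ℚ.*-zeroʳ (𝟙ℕ a k))
multiplicity-map-∷ a k t (r ∷ L) =
  trans (cong (𝟙ℕ a k * 𝟙ᶻ r t +_) (multiplicity-map-∷ a k t L)) (sym (ℚ.*-distribˡ-+ (𝟙ℕ a k) (𝟙ᶻ r t) (multiplicity t L)))

multiplicity-[]-map-∷ : ∀ a L → multiplicity [] (map (a ∷_) L) ≡ 0ℚ
multiplicity-[]-map-∷ a []      = refl
multiplicity-[]-map-∷ a (r ∷ L) = cong (0ℚ +_) (multiplicity-[]-map-∷ a L)

multiplicity-qsh₀ : ∀ t u v → multiplicity t (qsh₀ u v) ≡ (𝟙ᶻ u ✱ᶻ 𝟙ᶻ v) t
multiplicity-qsh₀ []      []      []      = refl
multiplicity-qsh₀ []      []      (_ ∷ _) = refl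
multiplicity-qsh₀ []      (_ ∷ _) []      = refl
multiplicity-qsh₀ []      (a ∷ u) (b ∷ v) = begin
  multiplicity [] (map (a ∷_) (qsh₀ u (b ∷ v)) ++ map (b ∷_) (qsh₀ (a ∷ u) v) ++ map (a ℕ.+ suc b ∷_) (qsh₀ u v))
    ≡⟨ multiplicity-++ [] (map (a ∷_) (qsh₀ u (b ∷ v))) _ ⟩
  multiplicity [] (map (a ∷_) (qsh₀ u (b ∷ v)))
    + multiplicity [] (map (b ∷_) (qsh₀ (a ∷ u) v) ++ map (a ℕ.+ suc b ∷_) (qsh₀ u v))
    ≡⟨ cong₂ _+_ (multiplicity-[]-map-∷ a (qsh₀ u (b ∷ v)))
                 (trans (multiplicity-++ [] (map (b ∷_) (qsh₀ (a ∷ u) v)) _)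
                        (cong₂ _+_ (multiplicity-[]-map-∷ b (qsh₀ (a ∷ u) v))
                                   (multiplicity-[]-map-∷ (a ℕ.+ suc b) (qsh₀ u v)))) ⟩
  0ℚ ∎
multiplicity-qsh₀ (k ∷ t) []      []      = sym (begin
  (const 0ℚ ✱ᶻ 𝟙ᶻ []) t + (𝟙ᶻ [] ✱ᶻ const 0ℚ) t + merged (λ _ _ → 0ℚ) (λ _ _ → 0ℚ) t k
    ≡⟨ cong₂ _+_ (cong₂ _+_ (✱ᶻˡ.0-homo (𝟙ᶻ []) t) (✱ᶻʳ.0-homo (𝟙ᶻ []) t)) (Mergedˡ.0-homo (λ _ _ → 0ℚ) (t , k)) ⟩
  0ℚ ∎)
multiplicity-qsh₀ (k ∷ t) []      (b ∷ v) = sym (begin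
  (const 0ℚ ✱ᶻ 𝟙ᶻ (b ∷ v)) t + (𝟙ᶻ [] ✱ᶻ (λ s → 𝟙ℕ b k * 𝟙ᶻ v s)) t + merged (λ _ _ → 0ℚ) (𝟙ᶻ (b ∷ v) ·_) t k
    ≡⟨ cong₂ _+_ (cong₂ _+_ (✱ᶻˡ.0-homo (𝟙ᶻ (b ∷ v)) t) (✱ᶻʳ.*-homo (𝟙ᶻ []) (𝟙ℕ b k) (𝟙ᶻ v) t))
                 (Mergedˡ.0-homo (𝟙ᶻ (b ∷ v) ·_) (t , k)) ⟩
  0ℚ + 𝟙ℕ b k * (𝟙ᶻ [] ✱ᶻ 𝟙ᶻ v) t + 0ℚ
    ≡⟨ cong (λ m → 0ℚ + 𝟙ℕ b k * m + 0ℚ) (multiplicity-qsh₀ t [] v) ⟨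
  0ℚ + 𝟙ℕ b k * multiplicity t (v ∷ []) + 0ℚ
    ≡⟨ trans (ℚ.+-identityʳ _) (ℚ.+-identityˡ _) ⟩
  𝟙ℕ b k * multiplicity t (v ∷ [])
    ≡⟨ multiplicity-map-∷ b k t (v ∷ []) ⟨
  multiplicity (k ∷ t) (map (b ∷_) (v ∷ [])) ∎)
multiplicity-qsh₀ (k ∷ t) (a ∷ u) []      = sym (begin
  ((λ s → 𝟙ℕ a k * 𝟙ᶻ u s) ✱ᶻ 𝟙ᶻ []) t + (𝟙ᶻ (a ∷ u) ✱ᶻ const 0ℚ) t + merged (𝟙ᶻ (a ∷ u) ·_) (λ _ _ → 0ℚ) t k
    ≡⟨ cong₂ _+_ (cong₂ _+_ (✱ᶻˡ.*-homo (𝟙ᶻ []) (𝟙ℕ a k) (𝟙ᶻ u) t) (✱ᶻʳ.0-homo (𝟙ᶻ (a ∷ u)) t))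
                 (Mergedʳ.0-homo (𝟙ᶻ (a ∷ u) ·_) (t , k)) ⟩
  𝟙ℕ a k * (𝟙ᶻ u ✱ᶻ 𝟙ᶻ []) t + 0ℚ + 0ℚ
    ≡⟨ cong (λ m → 𝟙ℕ a k * m + 0ℚ + 0ℚ)
         (trans (cong (multiplicity t) (sym (qsh₀-identityʳ u))) (multiplicity-qsh₀ t u [])) ⟨
  𝟙ℕ a k * multiplicity t (u ∷ []) + 0ℚ + 0ℚ
    ≡⟨ trans (ℚ.+-identityʳ _) (ℚ.+-identityʳ _) ⟩
  𝟙ℕ a k * multiplicity t (u ∷ [])
    ≡⟨ multiplicity-map-∷ a k t (u ∷ []) ⟨
  multiplicity (k ∷ t) (map (a ∷_) (u ∷ [])) ∎)
multiplicity-qsh₀ (k ∷ t) (a ∷ u) (b ∷ v) = begin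
  multiplicity (k ∷ t) (L₁ ++ L₂ ++ L₃)
    ≡⟨ trans (multiplicity-++ (k ∷ t) L₁ (L₂ ++ L₃)) (cong (multiplicity (k ∷ t) L₁ +_) (multiplicity-++ (k ∷ t) L₂ L₃)) ⟩
  multiplicity (k ∷ t) L₁ + (multiplicity (k ∷ t) L₂ + multiplicity (k ∷ t) L₃)
    ≡⟨ cong₂ _+_ (first-letter a (qsh₀ u (b ∷ v)) (multiplicity-qsh₀ t u (b ∷ v)))
                 (cong₂ _+_ (first-letter b (qsh₀ (a ∷ u) v) (multiplicity-qsh₀ t (a ∷ u) v))
                            (first-letter (a ℕ.+ suc b) (qsh₀ u v) (multiplicity-qsh₀ t u v))) ⟩
  S₁ + (S₂ + S₃)
    ≡⟨ ℚ.+-assoc S₁ S₂ S₃ ⟨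
  S₁ + S₂ + S₃
    ≡⟨ cong₂ _+_ (cong₂ _+_ (✱ᶻˡ.*-homo (𝟙ᶻ (b ∷ v)) (𝟙ℕ a k) (𝟙ᶻ u) t) (✱ᶻʳ.*-homo (𝟙ᶻ (a ∷ u)) (𝟙ℕ b k) (𝟙ᶻ v) t))
                 (merged-𝟙ℕ a b (𝟙ᶻ u) (𝟙ᶻ v) t k) ⟨
  (𝟙ᶻ (a ∷ u) ✱ᶻ 𝟙ᶻ (b ∷ v)) (k ∷ t) ∎
  where
  L₁ L₂ L₃ : List ZWord
  L₁ = map (a ∷_) (qsh₀ u (b ∷ v))
  L₂ = map (b ∷_) (qsh₀ (a ∷ u) v)
  L₃ = map (a ℕ.+ suc b ∷_) (qsh₀ u v)
  S₁ S₂ S₃ : ℚ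
  S₁ = 𝟙ℕ a k * (𝟙ᶻ u ✱ᶻ 𝟙ᶻ (b ∷ v)) t
  S₂ = 𝟙ℕ b k * (𝟙ᶻ (a ∷ u) ✱ᶻ 𝟙ᶻ v) t
  S₃ = 𝟙ℕ (a ℕ.+ suc b) k * (𝟙ᶻ u ✱ᶻ 𝟙ᶻ v) t
  first-letter : ∀ c L {S} → multiplicity t L ≡ S → multiplicity (k ∷ t) (map (c ∷_) L) ≡ 𝟙ℕ c k * S
  first-letter c L eq = trans (multiplicity-map-∷ c k t L) (cong (𝟙ℕ c k *_) eq)

-- δ and the weight are derivations of the quasi-shuffle product

IsDerivationAt : (Coeffs ZWord → Coeffs ZWord) → ZWord → Set
IsDerivationAt D t = ∀ f g → D (f ✱ᶻ g) t ≡ (D f ✱ᶻ g) t + (f ✱ᶻ D g) t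

δfirstᶻ : Coeffs ZWord → ℕ → Coeffs ZWord
δfirstᶻ f b t = ½ * f (0 ∷ suc b ∷ t) - ½ * f (suc b ∷ 0 ∷ t)

δmidᶻ : Coeffs ZWord → Coeffs ZWord
δmidᶻ f []      = 0ℚ
δmidᶻ f (b ∷ t) = δmidᶻ (f · b) t + δfirstᶻ f b t

δheadᶻ : Coeffs ZWord → Coeffs ZWord
δheadᶻ f t = ¼ * f (0 ∷ 0 ∷ t) - ½ * f (1 ∷ t)

δᶻ : Coeffs ZWord → Coeffs ZWord
δᶻ f t = δmidᶻ f t + δheadᶻ f t

δfirstᶻ-✱ᶻ : ∀ f g b t → δfirstᶻ (f ✱ᶻ g) b t ≡
  (δfirstᶻ f b ✱ᶻ g) t + (f ✱ᶻ δfirstᶻ g b) t + merged (δfirstᶻ f) (g ·_) t b + merged (f ·_) (δfirstᶻ g) t b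
δfirstᶻ-✱ᶻ f g b t = begin
  ½ * (f ✱ᶻ g) (0 ∷ suc b ∷ t) - ½ * (f ✱ᶻ g) (suc b ∷ 0 ∷ t)
    ≡⟨ cong₂ (λ p q → ½ * p - ½ * q) expand₁ expand₂ ⟩
  ½ * (b₁ + b₂ + (b₃ + b₄) + (b₅ + b₆ + (b₇ + b₈)) + 0ℚ)
    - ½ * (c₁ + b₅ + 0ℚ + (b₂ + c₂ + 0ℚ) + (b₃ + c₃ + (b₇ + c₄)))
    -- b₂, b₃, b₅ and b₇ occur in both expansions and cancel.
    ≡⟨ solve 12 (λ b₁ b₂ b₃ b₄ b₅ b₆ b₇ b₈ c₁ c₂ c₃ c₄ →
         con ½ :* (b₁ :+ b₂ :+ (b₃ :+ b₄) :+ (b₅ :+ b₆ :+ (b₇ :+ b₈)) :+ con 0ℚ)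
           :- con ½ :* (c₁ :+ b₅ :+ con 0ℚ :+ (b₂ :+ c₂ :+ con 0ℚ) :+ (b₃ :+ c₃ :+ (b₇ :+ c₄)))
         := (con ½ :* b₁ :- con ½ :* c₁) :+ (con ½ :* b₆ :- con ½ :* c₂)
              :+ (con ½ :* b₄ :- con ½ :* c₃) :+ (con ½ :* b₈ :- con ½ :* c₄))
         refl b₁ b₂ b₃ b₄ b₅ b₆ b₇ b₈ c₁ c₂ c₃ c₄ ⟩
  (½ * b₁ - ½ * c₁) + (½ * b₆ - ½ * c₂) + (½ * b₄ - ½ * c₃) + (½ * b₈ - ½ * c₄)
    ≡⟨ cong₂ _+_ (cong₂ _+_ (cong₂ _+_ (✱ᶻˡ.*-sub-homo g ½ (f · 0 · suc b) ½ (f · suc b · 0) t)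
                                      (✱ᶻʳ.*-sub-homo f ½ (g · 0 · suc b) ½ (g · suc b · 0) t))
                           (Mergedˡ.*-sub-homo (g ·_) ½ (λ (i , s) → f (0 ∷ suc i ∷ s))
                                                        ½ (λ (i , s) → f (suc i ∷ 0 ∷ s)) (t , b)))
                 (Mergedʳ.*-sub-homo (f ·_) ½ (λ (j , s) → g (0 ∷ suc j ∷ s))
                                            ½ (λ (j , s) → g (suc j ∷ 0 ∷ s)) (t , b)) ⟨
  (δfirstᶻ f b ✱ᶻ g) t + (f ✱ᶻ δfirstᶻ g b) t + merged (δfirstᶻ f) (g ·_) t b + merged (f ·_) (δfirstᶻ g) t b ∎
  where
  b₁ b₂ b₃ b₄ b₅ b₆ b₇ b₈ c₁ c₂ c₃ c₄ : ℚ
  b₁ = (f · 0 · suc b ✱ᶻ g) t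
  b₂ = (f · 0 ✱ᶻ g · suc b) t
  b₃ = (f · 0 · 0 ✱ᶻ g · b) t
  b₄ = merged (λ i s → f (0 ∷ suc i ∷ s)) (g ·_) t b
  b₅ = (f · suc b ✱ᶻ g · 0) t
  b₆ = (f ✱ᶻ g · 0 · suc b) t
  b₇ = (f · b ✱ᶻ g · 0 · 0) t
  b₈ = merged (f ·_) (λ j s → g (0 ∷ suc j ∷ s)) t b
  c₁ = (f · suc b · 0 ✱ᶻ g) t
  c₂ = (f ✱ᶻ g · suc b · 0) t
  c₃ = merged (λ i s → f (suc i ∷ 0 ∷ s)) (g ·_) t b
  c₄ = merged (f ·_) (λ j s → g (suc j ∷ 0 ∷ s)) t b
  expand₁ : (f ✱ᶻ g) (0 ∷ suc b ∷ t) ≡ b₁ + b₂ + (b₃ + b₄) + (b₅ + b₆ + (b₇ + b₈)) + 0ℚ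
  expand₁ = cong (λ m → b₁ + b₂ + (b₃ + b₄) + (b₅ + b₆ + m) + 0ℚ) (merged-last (f ·_) (g · 0 ·_) t b)
  expand₂ : (f ✱ᶻ g) (suc b ∷ 0 ∷ t) ≡ c₁ + b₅ + 0ℚ + (b₂ + c₂ + 0ℚ) + (b₃ + c₃ + (b₇ + c₄))
  expand₂ = cong (c₁ + b₅ + 0ℚ + (b₂ + c₂ + 0ℚ) +_)
    (trans (merged-0∷ (f ·_) (g ·_) t (suc b)) (cong (b₃ + c₃ +_) (merged-last (f ·_) (λ j s → g (j ∷ 0 ∷ s)) t b)))

δmidᶻ-isLinear : IsLinear δmidᶻ
δmidᶻ-isLinear = record { cong-≗ = cong-≗ ; linear = linear }
  where
  cong-≗ : ∀ {f g} → f ≗ g → δmidᶻ f ≗ δmidᶻ g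
  cong-≗ f≗g []      = refl
  cong-≗ f≗g (b ∷ t) = cong₂ _+_ (cong-≗ (λ s → f≗g (b ∷ s)) t) (cong₂ (λ p q → ½ * p - ½ * q) (f≗g _) (f≗g _))
  linear : ∀ c f g → δmidᶻ (λ s → c * f s + g s) ≗ λ t → c * δmidᶻ f t + δmidᶻ g t
  linear c f g []      = linear-0 c
  linear c f g (b ∷ t) = trans (cong₂ _+_ (linear c _ _ t) refl) (solve 7 (λ c a b f₁ g₁ f₂ g₂ →
      c :* a :+ b :+ (con ½ :* (c :* f₁ :+ g₁) :- con ½ :* (c :* f₂ :+ g₂))
      := c :* (a :+ (con ½ :* f₁ :- con ½ :* f₂)) :+ (b :+ (con ½ :* g₁ :- con ½ :* g₂)))
      refl c (δmidᶻ (f · b) t) (δmidᶻ (g · b) t)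
      (f (0 ∷ suc b ∷ t)) (g (0 ∷ suc b ∷ t)) (f (suc b ∷ 0 ∷ t)) (g (suc b ∷ 0 ∷ t)))

module Δmidᶻ = IsLinear δmidᶻ-isLinear

merged-δmidᶻ : ∀ {t} → IsDerivationAt δmidᶻ t → ∀ F G k →
  δmidᶻ (λ s → merged F G s k) t ≡ merged (λ i → δmidᶻ (F i)) G t k + merged F (λ j → δmidᶻ (G j)) t k
merged-δmidᶻ {t = t} ih F G zero    = Δmidᶻ.0-homo t
merged-δmidᶻ {t = t} ih F G (suc k) = begin
  δmidᶻ (λ s → (F 0 ✱ᶻ G k) s + merged (λ i → F (suc i)) G s k) t
    ≡⟨ Δmidᶻ.+-homo (F 0 ✱ᶻ G k) (λ s → merged (λ i → F (suc i)) G s k) t ⟩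
  δmidᶻ (F 0 ✱ᶻ G k) t + δmidᶻ (λ s → merged (λ i → F (suc i)) G s k) t
    ≡⟨ cong₂ _+_ (ih (F 0) (G k)) (merged-δmidᶻ ih (λ i → F (suc i)) G k) ⟩
  (δmidᶻ (F 0) ✱ᶻ G k) t + (F 0 ✱ᶻ δmidᶻ (G k)) t
    + (merged (λ i → δmidᶻ (F (suc i))) G t k + merged (λ i → F (suc i)) (λ j → δmidᶻ (G j)) t k)
    ≡⟨ interchange ((δmidᶻ (F 0) ✱ᶻ G k) t) ((F 0 ✱ᶻ δmidᶻ (G k)) t) _ _ ⟩
  (δmidᶻ (F 0) ✱ᶻ G k) t + merged (λ i → δmidᶻ (F (suc i))) G t k
    + ((F 0 ✱ᶻ δmidᶻ (G k)) t + merged (λ i → F (suc i)) (λ j → δmidᶻ (G j)) t k) ∎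

δmidᶻ-✱ᶻ : ∀ t → IsDerivationAt δmidᶻ t
δmidᶻ-✱ᶻ []      f g = solve 2 (λ a b → con 0ℚ := con 0ℚ :* a :+ b :* con 0ℚ) refl (g []) (f [])
δmidᶻ-✱ᶻ (b ∷ t) f g = begin
  δmidᶻ (λ s → (f · b ✱ᶻ g) s + (f ✱ᶻ g · b) s + merged (f ·_) (g ·_) s b) t + δfirstᶻ (f ✱ᶻ g) b t
    ≡⟨ cong₂ _+_ shifted (δfirstᶻ-✱ᶻ f g b t) ⟩
  a₁ + a₂ + (a₃ + a₄) + (a₅ + a₆) + (l₁ + l₂ + l₃ + l₄)
    ≡⟨ solve 10 (λ a₁ a₂ a₃ a₄ a₅ a₆ l₁ l₂ l₃ l₄ →
         a₁ :+ a₂ :+ (a₃ :+ a₄) :+ (a₅ :+ a₆) :+ (l₁ :+ l₂ :+ l₃ :+ l₄)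
         := a₁ :+ l₁ :+ a₃ :+ (a₅ :+ l₃) :+ (a₂ :+ (a₄ :+ l₂) :+ (a₆ :+ l₄)))
         refl a₁ a₂ a₃ a₄ a₅ a₆ l₁ l₂ l₃ l₄ ⟩
  a₁ + l₁ + a₃ + (a₅ + l₃) + (a₂ + (a₄ + l₂) + (a₆ + l₄))
    ≡⟨ cong₂ _+_ (cong₂ _+_ (cong (_+ a₃) (✱ᶻˡ.+-homo g (δmidᶻ (f · b)) (δfirstᶻ f b) t))
                            (Mergedˡ.+-homo (g ·_) (λ (i , s) → δmidᶻ (f · i) s) (λ (i , s) → δfirstᶻ f i s) (t , b)))
                 (cong₂ _+_ (cong (a₂ +_) (✱ᶻʳ.+-homo f (δmidᶻ (g · b)) (δfirstᶻ g b) t))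
                            (Mergedʳ.+-homo (f ·_) (λ (j , s) → δmidᶻ (g · j) s) (λ (j , s) → δfirstᶻ g j s) (t , b))) ⟨
  (δmidᶻ f ✱ᶻ g) (b ∷ t) + (f ✱ᶻ δmidᶻ g) (b ∷ t) ∎
  where
  a₁ a₂ a₃ a₄ a₅ a₆ l₁ l₂ l₃ l₄ : ℚ
  a₁ = (δmidᶻ (f · b) ✱ᶻ g) t
  a₂ = (f · b ✱ᶻ δmidᶻ g) t
  a₃ = (δmidᶻ f ✱ᶻ g · b) t
  a₄ = (f ✱ᶻ δmidᶻ (g · b)) t
  a₅ = merged (λ i → δmidᶻ (f · i)) (g ·_) t b
  a₆ = merged (f ·_) (λ j → δmidᶻ (g · j)) t b
  l₁ = (δfirstᶻ f b ✱ᶻ g) t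
  l₂ = (f ✱ᶻ δfirstᶻ g b) t
  l₃ = merged (δfirstᶻ f) (g ·_) t b
  l₄ = merged (f ·_) (δfirstᶻ g) t b
  shifted : δmidᶻ (λ s → (f · b ✱ᶻ g) s + (f ✱ᶻ g · b) s + merged (f ·_) (g ·_) s b) t
            ≡ a₁ + a₂ + (a₃ + a₄) + (a₅ + a₆)
  shifted = begin
    δmidᶻ (λ s → (f · b ✱ᶻ g) s + (f ✱ᶻ g · b) s + merged (f ·_) (g ·_) s b) t
      ≡⟨ Δmidᶻ.+-homo (λ s → (f · b ✱ᶻ g) s + (f ✱ᶻ g · b) s) (λ s → merged (f ·_) (g ·_) s b) t ⟩
    δmidᶻ (λ s → (f · b ✱ᶻ g) s + (f ✱ᶻ g · b) s) t + δmidᶻ (λ s → merged (f ·_) (g ·_) s b) t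
      ≡⟨ cong₂ _+_ (Δmidᶻ.+-homo (f · b ✱ᶻ g) (f ✱ᶻ g · b) t) (merged-δmidᶻ (δmidᶻ-✱ᶻ t) (f ·_) (g ·_) b) ⟩
    δmidᶻ (f · b ✱ᶻ g) t + δmidᶻ (f ✱ᶻ g · b) t + (a₅ + a₆)
      ≡⟨ cong (λ p → p + (a₅ + a₆)) (cong₂ _+_ (δmidᶻ-✱ᶻ t (f · b) g) (δmidᶻ-✱ᶻ t f (g · b))) ⟩
    a₁ + a₂ + (a₃ + a₄) + (a₅ + a₆) ∎

δheadᶻ-✱ᶻ : ∀ t → IsDerivationAt δheadᶻ t
δheadᶻ-✱ᶻ t f g = begin
  ¼ * (u + r + 0ℚ + (r + v + 0ℚ) + 0ℚ) - ½ * (p + q + (r + 0ℚ))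
    ≡⟨ solve 5 (λ u r v p q → con ¼ :* (u :+ r :+ con 0ℚ :+ (r :+ v :+ con 0ℚ) :+ con 0ℚ)
                              :- con ½ :* (p :+ q :+ (r :+ con 0ℚ))
                            := con ¼ :* u :- con ½ :* p :+ (con ¼ :* v :- con ½ :* q)) refl u r v p q ⟩
  ¼ * u - ½ * p + (¼ * v - ½ * q)
    ≡⟨ cong₂ _+_ (✱ᶻˡ.*-sub-homo g ¼ (f · 0 · 0) ½ (f · 1) t) (✱ᶻʳ.*-sub-homo f ¼ (g · 0 · 0) ½ (g · 1) t) ⟨
  (δheadᶻ f ✱ᶻ g) t + (f ✱ᶻ δheadᶻ g) t ∎
  where
  u r v p q : ℚ
  u = (f · 0 · 0 ✱ᶻ g) t
  r = (f · 0 ✱ᶻ g · 0) t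
  v = (f ✱ᶻ g · 0 · 0) t
  p = (f · 1 ✱ᶻ g) t
  q = (f ✱ᶻ g · 1) t

δᶻ-✱ᶻ : ∀ t → IsDerivationAt δᶻ t
δᶻ-✱ᶻ t f g = begin
  δmidᶻ (f ✱ᶻ g) t + δheadᶻ (f ✱ᶻ g) t
    ≡⟨ cong₂ _+_ (δmidᶻ-✱ᶻ t f g) (δheadᶻ-✱ᶻ t f g) ⟩
  (δmidᶻ f ✱ᶻ g) t + (f ✱ᶻ δmidᶻ g) t + ((δheadᶻ f ✱ᶻ g) t + (f ✱ᶻ δheadᶻ g) t)
    ≡⟨ interchange ((δmidᶻ f ✱ᶻ g) t) ((f ✱ᶻ δmidᶻ g) t) _ _ ⟩
  (δmidᶻ f ✱ᶻ g) t + (δheadᶻ f ✱ᶻ g) t + ((f ✱ᶻ δmidᶻ g) t + (f ✱ᶻ δheadᶻ g) t)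
    ≡⟨ cong₂ _+_ (✱ᶻˡ.+-homo g (δmidᶻ f) (δheadᶻ f) t) (✱ᶻʳ.+-homo f (δmidᶻ g) (δheadᶻ g) t) ⟨
  (δᶻ f ✱ᶻ g) t + (f ✱ᶻ δᶻ g) t ∎

δᶻ-cong : ∀ {F G} → F ≗ G → δᶻ F ≗ δᶻ G
δᶻ-cong F≗G t = cong₂ _+_ (Δmidᶻ.cong-≗ F≗G t) (cong₂ (λ a b → ¼ * a - ½ * b) (F≗G _) (F≗G _))

toℚ : ℕ → ℚ
toℚ zero    = 0ℚ
toℚ (suc n) = 1ℚ + toℚ n

toℚ-+ : ∀ m n → toℚ (m ℕ.+ n) ≡ toℚ m + toℚ n
toℚ-+ zero    n = sym (ℚ.+-identityˡ (toℚ n))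
toℚ-+ (suc m) n = trans (cong (1ℚ +_) (toℚ-+ m n)) (sym (ℚ.+-assoc 1ℚ (toℚ m) (toℚ n)))

weightᶻ : ZWord → ℚ
weightᶻ []      = 0ℚ
weightᶻ (k ∷ t) = toℚ (suc k) + weightᶻ t

weightedᶻ : Coeffs ZWord → Coeffs ZWord
weightedᶻ f t = weightᶻ t * f t

weightedᶻ-offset : ∀ (c : ℚ) f → (λ s → (c + weightᶻ s) * f s) ≗ λ s → c * f s + weightedᶻ f s
weightedᶻ-offset c f s = ℚ.*-distribʳ-+ (f s) c (weightᶻ s)

-- α i is the weight of the first letter of F i; it must stay general because the recursion shifts F.
merged-weightedᶻ : ∀ {t} → IsDerivationAt weightedᶻ t → ∀ (α : ℕ → ℚ) c F G k →
  (∀ i j → i ℕ.+ suc j ≡ k → α i + toℚ (suc j) ≡ c) →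
  merged (λ i s → (α i + weightᶻ s) * F i s) G t k + merged F (λ j s → (toℚ (suc j) + weightᶻ s) * G j s) t k
  ≡ (c + weightᶻ t) * merged F G t k
merged-weightedᶻ {t} ih α c F G zero    weights = sym (ℚ.*-zeroʳ (c + weightᶻ t))
merged-weightedᶻ {t} ih α c F G (suc k) weights = begin
  ((λ s → (α 0 + weightᶻ s) * F 0 s) ✱ᶻ G k) t + merged (λ i s → (α (suc i) + weightᶻ s) * F (suc i) s) G t k
    + ((F 0 ✱ᶻ (λ s → (toℚ (suc k) + weightᶻ s) * G k s)) t + M′)
    ≡⟨ cong₂ (λ p q → p + M₁ + (q + M′))
         (trans (✱ᶻ-cong (weightedᶻ-offset (α 0) (F 0)) (λ _ → refl) t) (✱ᶻ-linearˡ (α 0) (F 0) (weightedᶻ (F 0)) (G k) t))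
         (trans (✱ᶻ-cong (λ _ → refl) (weightedᶻ-offset (toℚ (suc k)) (G k)) t)
                (✱ᶻ-linearʳ (toℚ (suc k)) (F 0) (G k) (weightedᶻ (G k)) t)) ⟩
  α 0 * S + P + M₁ + (toℚ (suc k) * S + Q + M′)
    ≡⟨ solve 7 (λ a b S P Q M₁ M′ → a :* S :+ P :+ M₁ :+ (b :* S :+ Q :+ M′) := (a :+ b) :* S :+ (P :+ Q) :+ (M₁ :+ M′))
         refl (α 0) (toℚ (suc k)) S P Q M₁ M′ ⟩
  (α 0 + toℚ (suc k)) * S + (P + Q) + (M₁ + M′)
    ≡⟨ cong₂ _+_ (cong₂ _+_ (cong (_* S) (weights 0 k refl)) (sym (ih (F 0) (G k))))
                 (merged-weightedᶻ ih (λ i → α (suc i)) c (λ i → F (suc i)) G k (λ i j e → weights (suc i) j (cong suc e))) ⟩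
  c * S + weightᶻ t * S + (c + weightᶻ t) * M
    ≡⟨ solve 4 (λ c w S M → c :* S :+ w :* S :+ (c :+ w) :* M := (c :+ w) :* (S :+ M)) refl c (weightᶻ t) S M ⟩
  (c + weightᶻ t) * (S + M) ∎
  where
  S P Q M M₁ M′ : ℚ
  S = (F 0 ✱ᶻ G k) t
  P = (weightedᶻ (F 0) ✱ᶻ G k) t
  Q = (F 0 ✱ᶻ weightedᶻ (G k)) t
  M = merged (λ i → F (suc i)) G t k
  M₁ = merged (λ i s → (α (suc i) + weightᶻ s) * F (suc i) s) G t k
  M′ = merged (λ i → F (suc i)) (λ j s → (toℚ (suc j) + weightᶻ s) * G j s) t k

weightedᶻ-✱ᶻ : ∀ t → IsDerivationAt weightedᶻ t
weightedᶻ-✱ᶻ []      f g = solve 2 (λ a b → con 0ℚ :* (a :* b) := con 0ℚ :* a :* b :+ a :* (con 0ℚ :* b)) refl (f []) (g [])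
weightedᶻ-✱ᶻ (k ∷ t) f g = sym (begin
  ((weightedᶻ f · k) ✱ᶻ g) t + (weightedᶻ f ✱ᶻ g · k) t + M₁ + ((f · k ✱ᶻ weightedᶻ g) t + (f ✱ᶻ (weightedᶻ g · k)) t + M₂)
    ≡⟨ cong₂ (λ p q → p + B′ + M₁ + (A′ + q + M₂))
         (trans (✱ᶻ-cong (weightedᶻ-offset n (f · k)) (λ _ → refl) t) (✱ᶻ-linearˡ n (f · k) (weightedᶻ (f · k)) g t))
         (trans (✱ᶻ-cong (λ _ → refl) (weightedᶻ-offset n (g · k)) t) (✱ᶻ-linearʳ n f (g · k) (weightedᶻ (g · k)) t)) ⟩
  n * A + WA + B′ + M₁ + (A′ + (n * B + WB) + M₂)
    ≡⟨ solve 9 (λ n A WA B′ M₁ A′ B WB M₂ → n :* A :+ WA :+ B′ :+ M₁ :+ (A′ :+ (n :* B :+ WB) :+ M₂)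
                := n :* A :+ (WA :+ A′) :+ (n :* B :+ (B′ :+ WB)) :+ (M₁ :+ M₂)) refl n A WA B′ M₁ A′ B WB M₂ ⟩
  n * A + (WA + A′) + (n * B + (B′ + WB)) + (M₁ + M₂)
    ≡⟨ cong₂ _+_ (cong₂ _+_ (cong (n * A +_) (sym (weightedᶻ-✱ᶻ t (f · k) g)))
                            (cong (n * B +_) (sym (weightedᶻ-✱ᶻ t f (g · k)))))
                 (merged-weightedᶻ (weightedᶻ-✱ᶻ t) (λ i → toℚ (suc i)) n (f ·_) (g ·_) k letters) ⟩
  n * A + weightᶻ t * A + (n * B + weightᶻ t * B) + (n + weightᶻ t) * M
    ≡⟨ solve 5 (λ n w A B M → n :* A :+ w :* A :+ (n :* B :+ w :* B) :+ (n :+ w) :* M := (n :+ w) :* (A :+ B :+ M))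
         refl n (weightᶻ t) A B M ⟩
  (n + weightᶻ t) * (A + B + M) ∎)
  where
  n A B M WA A′ B′ WB M₁ M₂ : ℚ
  n = toℚ (suc k)
  A = (f · k ✱ᶻ g) t
  B = (f ✱ᶻ g · k) t
  M = merged (f ·_) (g ·_) t k
  WA = (weightedᶻ (f · k) ✱ᶻ g) t
  A′ = (f · k ✱ᶻ weightedᶻ g) t
  B′ = (weightedᶻ f ✱ᶻ g · k) t
  WB = (f ✱ᶻ weightedᶻ (g · k)) t
  M₁ = merged (weightedᶻ f ·_) (g ·_) t k
  M₂ = merged (f ·_) (weightedᶻ g ·_) t k
  letters : ∀ i j → i ℕ.+ suc j ≡ k → toℚ (suc i) + toℚ (suc j) ≡ n
  letters i j refl = begin
    toℚ (suc i) + toℚ (suc j)  ≡⟨ ℚ.+-assoc 1ℚ (toℚ i) (toℚ (suc j)) ⟩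
    1ℚ + (toℚ i + toℚ (suc j)) ≡⟨ cong (1ℚ +_) (toℚ-+ i (suc j)) ⟨
    toℚ (suc (i ℕ.+ suc j))    ∎

-- Words versus z-words

unparse₀ : ZWord → Word
unparse₀ []      = []
unparse₀ (k ∷ t) = replicate k x ++ y ∷ unparse₀ t

-- The accumulator counts the x's read since the last y.
parse₀-from : ℕ → Word → Maybe ZWord
parse₀-from a       (x ∷ w) = parse₀-from (suc a) w
parse₀-from a       (y ∷ w) = Maybe.map (a ∷_) (parse₀-from 0 w)
parse₀-from zero    []      = just []
parse₀-from (suc _) []      = nothing

parse₀ : Word → Maybe ZWord
parse₀ = parse₀-from 0

parseGo-parse₀-from : ∀ a w → parseGo a w ≡ Maybe.map (map suc) (parse₀-from a w)
parseGo-parse₀-from zero    []      = refl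
parseGo-parse₀-from (suc a) []      = refl
parseGo-parse₀-from zero    (x ∷ w) = parseGo-parse₀-from 1 w
parseGo-parse₀-from (suc a) (x ∷ w) = parseGo-parse₀-from (suc (suc a)) w
parseGo-parse₀-from a       (y ∷ w) = begin
  parseGo a (y ∷ w)                                         ≡⟨ parseGo-y a ⟩
  Maybe.map (suc a ∷_) (parseGo 0 w)                        ≡⟨ cong (Maybe.map (suc a ∷_)) (parseGo-parse₀-from 0 w) ⟩
  Maybe.map (suc a ∷_) (Maybe.map (map suc) (parse₀ w))     ≡⟨ Maybe.map-∘ (parse₀ w) ⟨
  Maybe.map (λ t → suc a ∷ map suc t) (parse₀ w)            ≡⟨ Maybe.map-∘ (parse₀ w) ⟩
  Maybe.map (map suc) (Maybe.map (a ∷_) (parse₀ w))         ∎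
  where
  parseGo-y : ∀ a → parseGo a (y ∷ w) ≡ Maybe.map (suc a ∷_) (parseGo 0 w)
  parseGo-y zero    = refl
  parseGo-y (suc a) = refl

parse₀-from-x^ : ∀ k a w → parse₀-from a (replicate k x ++ w) ≡ parse₀-from (k ℕ.+ a) w
parse₀-from-x^ zero    a w = refl
parse₀-from-x^ (suc k) a w = trans (parse₀-from-x^ k (suc a) w) (cong (λ n → parse₀-from n w) (ℕ.+-suc k a))

parse₀-unparse₀ : ∀ t → parse₀ (unparse₀ t) ≡ just t
parse₀-unparse₀ []      = refl
parse₀-unparse₀ (k ∷ t) = begin
  parse₀ (replicate k x ++ y ∷ unparse₀ t)   ≡⟨ parse₀-from-x^ k 0 (y ∷ unparse₀ t) ⟩
  parse₀-from (k ℕ.+ 0) (y ∷ unparse₀ t)     ≡⟨ cong (λ n → parse₀-from n (y ∷ unparse₀ t)) (ℕ.+-identityʳ k) ⟩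
  Maybe.map (k ∷_) (parse₀ (unparse₀ t))     ≡⟨ cong (Maybe.map (k ∷_)) (parse₀-unparse₀ t) ⟩
  just (k ∷ t)                               ∎

x^-∷ : ∀ k (w : Word) → replicate k x ++ x ∷ w ≡ x ∷ replicate k x ++ w
x^-∷ zero    w = refl
x^-∷ (suc k) w = cong (x ∷_) (x^-∷ k w)

parse₀-from-just : ∀ a w {t} → parse₀-from a w ≡ just t → replicate a x ++ w ≡ unparse₀ t
parse₀-from-just zero    []      refl = refl
parse₀-from-just (suc a) []      ()
parse₀-from-just a       (x ∷ w) eq   = trans (x^-∷ a w) (parse₀-from-just (suc a) w eq)
parse₀-from-just a       (y ∷ w) eq   with parse₀ w in eq′
parse₀-from-just a       (y ∷ w) refl | just t = cong (λ v → replicate a x ++ y ∷ v) (parse₀-from-just 0 w eq′)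

parse₀-just : ∀ {w t} → parse₀ w ≡ just t → w ≡ unparse₀ t
parse₀-just = parse₀-from-just 0 _

parse₀-from-nothing : ∀ a w → parse₀-from a w ≡ nothing → EndsX (replicate a x ++ w)
parse₀-from-nothing zero    []      ()
parse₀-from-nothing (suc a) []      _  = subst EndsX (sym (List.++-identityʳ (replicate (suc a) x))) (EndsX-x^ a)
parse₀-from-nothing a       (x ∷ w) eq = subst EndsX (sym (x^-∷ a w)) (parse₀-from-nothing (suc a) w eq)
parse₀-from-nothing a       (y ∷ w) eq with parse₀ w in eq′
parse₀-from-nothing a       (y ∷ w) () | just _
parse₀-from-nothing a       (y ∷ w) _  | nothing = EndsX-++ (replicate a x) (there (parse₀-from-nothing 0 w eq′))

¬EndsX-unparse₀ : ∀ t → ¬ EndsX (unparse₀ t)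
¬EndsX-unparse₀ []      ()
¬EndsX-unparse₀ (k ∷ t) e = ¬EndsX-unparse₀ t (drop-x^ k e)
  where
  tail : ∀ {l u w} → EndsX (l ∷ u ∷ w) → EndsX (u ∷ w)
  tail (there e) = e
  drop-x^ : ∀ k {w} → EndsX (replicate k x ++ y ∷ w) → EndsX w
  drop-x^ zero          (there e) = e
  drop-x^ (suc zero)    e         = drop-x^ zero (tail e)
  drop-x^ (suc (suc k)) e         = drop-x^ (suc k) (tail e)

data H¹View : Word → Set where
  unparsed : ∀ t → H¹View (unparse₀ t)
  endsX    : ∀ {w} → EndsX w → parse₀ w ≡ nothing → H¹View w

h¹View : ∀ w → H¹View w
h¹View w with parse₀ w in eq
... | just t  = subst H¹View (sym (parse₀-just eq)) (unparsed t)
... | nothing = endsX (parse₀-from-nothing 0 w eq) eq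

EndsX⇒parse₀-nothing : ∀ {w} → EndsX w → parse₀ w ≡ nothing
EndsX⇒parse₀-nothing {w} e with parse₀ w in eq
... | just t  = ⊥-elim (¬EndsX-unparse₀ t (subst EndsX (parse₀-just eq) e))
... | nothing = refl

H¹-ext : ∀ {f g} → SupportedOnH¹ f → SupportedOnH¹ g → (∀ t → f (unparse₀ t) ≡ g (unparse₀ t)) → f ≗ g
H¹-ext {f} {g} f-supp g-supp f≡g w with h¹View w
... | unparsed t = f≡g t
... | endsX e _  = trans (f-supp e) (sym (g-supp e))

𝟙-x^ : ∀ a k u w → 𝟙 (replicate a x ++ y ∷ u) (replicate k x ++ y ∷ w) ≡ 𝟙ℕ a k * 𝟙 u w
𝟙-x^ zero    zero    u w = trans (𝟙-∷ y u w) (sym (ℚ.*-identityˡ (𝟙 u w)))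
𝟙-x^ zero    (suc k) u w = trans (𝟙-∷-∷ y x u w′) (trans (ℚ.*-zeroˡ (𝟙 u w′)) (sym (ℚ.*-zeroˡ (𝟙 u w))))
  where
  w′ : Word
  w′ = replicate k x ++ y ∷ w
𝟙-x^ (suc a) zero    u w = trans (𝟙-∷-∷ x y u′ w) (trans (ℚ.*-zeroˡ (𝟙 u′ w)) (sym (ℚ.*-zeroˡ (𝟙 u w))))
  where
  u′ : Word
  u′ = replicate a x ++ y ∷ u
𝟙-x^ (suc a) (suc k) u w = trans (𝟙-∷ x (replicate a x ++ y ∷ u) (replicate k x ++ y ∷ w)) (𝟙-x^ a k u w)

𝟙-unparse₀ : ∀ r → 𝟙 (unparse₀ r) ∘ unparse₀ ≗ 𝟙ᶻ r
𝟙-unparse₀ []      []            = refl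
𝟙-unparse₀ []      (zero ∷ s)    = refl
𝟙-unparse₀ []      (suc k ∷ s)   = refl
𝟙-unparse₀ (zero ∷ r)  []        = refl
𝟙-unparse₀ (suc a ∷ r) []        = refl
𝟙-unparse₀ (a ∷ r) (k ∷ s)       = trans (𝟙-x^ a k (unparse₀ r) (unparse₀ s)) (cong (𝟙ℕ a k *_) (𝟙-unparse₀ r s))

𝟙-unparse₀-supported : ∀ r → SupportedOnH¹ (𝟙 (unparse₀ r))
𝟙-unparse₀-supported r e = 𝟙-≢ (λ eq → ¬EndsX-unparse₀ r (subst EndsX (sym eq) e))

𝟙-EndsX : ∀ {u} → EndsX u → ∀ s → 𝟙 u (unparse₀ s) ≡ 0ℚ
𝟙-EndsX e s = 𝟙-≢ (λ eq → ¬EndsX-unparse₀ s (subst EndsX eq e))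

lengthℚ-x^ : ∀ k w → lengthℚ (replicate k x ++ w) ≡ toℚ k + lengthℚ w
lengthℚ-x^ zero    w = sym (ℚ.+-identityˡ (lengthℚ w))
lengthℚ-x^ (suc k) w = trans (cong (1ℚ +_) (lengthℚ-x^ k w)) (sym (ℚ.+-assoc 1ℚ (toℚ k) (lengthℚ w)))

lengthℚ-unparse₀ : ∀ t → lengthℚ (unparse₀ t) ≡ weightᶻ t
lengthℚ-unparse₀ []      = refl
lengthℚ-unparse₀ (k ∷ t) = begin
  lengthℚ (replicate k x ++ y ∷ unparse₀ t)   ≡⟨ lengthℚ-x^ k (y ∷ unparse₀ t) ⟩
  toℚ k + (1ℚ + lengthℚ (unparse₀ t))        ≡⟨ cong (λ l → toℚ k + (1ℚ + l)) (lengthℚ-unparse₀ t) ⟩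
  toℚ k + (1ℚ + weightᶻ t)
    ≡⟨ solve 2 (λ k w → k :+ (con 1ℚ :+ w) := con 1ℚ :+ k :+ w) refl (toℚ k) (weightᶻ t) ⟩
  1ℚ + toℚ k + weightᶻ t                     ∎

δmidᶜ-x^ : ∀ k f w → δmidᶜ f (replicate k x ++ w) ≡ δmidᶜ (λ v → f (replicate k x ++ v)) w
δmidᶜ-x^ zero    f w = refl
δmidᶜ-x^ (suc k) f w = δmidᶜ-x^ k (f · x) w

-- The yx-part of δhead becomes, on z-words, the first-letter term ½ f (0 ∷ suc b ∷ t) of δmidᶻ.
δmidᶜ-unparse₀ : ∀ {f} → SupportedOnH¹ f → ∀ t →
  δmidᶜ f (unparse₀ t) + ½ * f (y ∷ x ∷ unparse₀ t) ≡ δmidᶻ (f ∘ unparse₀) t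
δmidᶜ-unparse₀ f-supp []      = cong (λ a → 0ℚ + ½ * a) (f-supp (there here))
δmidᶜ-unparse₀ {f} f-supp (b ∷ t) = begin
  δmidᶜ f (replicate b x ++ y ∷ unparse₀ t) + ½ * P
    ≡⟨ cong (_+ ½ * P) (δmidᶜ-x^ b f (y ∷ unparse₀ t)) ⟩
  δmidᶜ f′ (unparse₀ t) + (½ * f′ (y ∷ x ∷ unparse₀ t) - ½ * f (replicate b x ++ x ∷ y ∷ y ∷ unparse₀ t)) + ½ * P
    ≡⟨ cong (λ v → δmidᶜ f′ (unparse₀ t) + (½ * f′ (y ∷ x ∷ unparse₀ t) - ½ * f v) + ½ * P) (x^-∷ b (y ∷ y ∷ unparse₀ t)) ⟩
  δmidᶜ f′ (unparse₀ t) + (½ * f′ (y ∷ x ∷ unparse₀ t) - ½ * Q) + ½ * P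
    ≡⟨ solve 4 (λ M Y Q P → M :+ (con ½ :* Y :- con ½ :* Q) :+ con ½ :* P := M :+ con ½ :* Y :+ (con ½ :* P :- con ½ :* Q))
         refl (δmidᶜ f′ (unparse₀ t)) (f′ (y ∷ x ∷ unparse₀ t)) Q P ⟩
  δmidᶜ f′ (unparse₀ t) + ½ * f′ (y ∷ x ∷ unparse₀ t) + (½ * P - ½ * Q)
    ≡⟨ cong (_+ (½ * P - ½ * Q)) (δmidᶜ-unparse₀ (λ e → f-supp (EndsX-++ (replicate b x) (there e))) t) ⟩
  δmidᶻ (f ∘ unparse₀ · b) t + (½ * P - ½ * Q) ∎
  where
  f′ : Coeffs Word
  f′ v = f (replicate b x ++ y ∷ v)
  P Q : ℚ
  P = f (unparse₀ (0 ∷ suc b ∷ t))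
  Q = f (unparse₀ (suc b ∷ 0 ∷ t))

δᶜ-unparse₀ : ∀ {f} → SupportedOnH¹ f → ∀ t → δᶜ f (unparse₀ t) ≡ δᶻ (f ∘ unparse₀) t
δᶜ-unparse₀ {f} f-supp t = begin
  ½ * A - ½ * B + ¼ * C + δmidᶜ f (unparse₀ t)
    ≡⟨ solve 4 (λ A B C M → con ½ :* A :- con ½ :* B :+ con ¼ :* C :+ M := M :+ con ½ :* A :+ (con ¼ :* C :- con ½ :* B))
         refl A B C (δmidᶜ f (unparse₀ t)) ⟩
  δmidᶜ f (unparse₀ t) + ½ * A + (¼ * C - ½ * B)
    ≡⟨ cong (_+ (¼ * C - ½ * B)) (δmidᶜ-unparse₀ f-supp t) ⟩
  δᶻ (f ∘ unparse₀) t ∎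
  where
  A B C : ℚ
  A = f (y ∷ x ∷ unparse₀ t)
  B = f (unparse₀ (1 ∷ t))
  C = f (unparse₀ (0 ∷ 0 ∷ t))

unparse-map-suc : ∀ t → unparse (map suc t) ≡ unparse₀ t
unparse-map-suc []      = refl
unparse-map-suc (k ∷ t) = trans (List.++-assoc (replicate k x) (y ∷ []) (unparse (map suc t)))
                                (cong (λ w → replicate k x ++ y ∷ w) (unparse-map-suc t))

qsh-map-suc : ∀ s t → qsh (map suc s) (map suc t) ≡ map (map suc) (qsh₀ s t)
qsh-map-suc []      t       = refl
qsh-map-suc (a ∷ s) []      = refl
qsh-map-suc (a ∷ s) (b ∷ t) = begin
  map (suc a ∷_) (qsh (map suc s) (suc b ∷ map suc t)) ++ map (suc b ∷_) (qsh (suc a ∷ map suc s) (map suc t))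
    ++ map (suc (a ℕ.+ suc b) ∷_) (qsh (map suc s) (map suc t))
    ≡⟨ cong₂ (λ L M → map (suc a ∷_) L ++ M) (qsh-map-suc s (b ∷ t))
         (cong₂ (λ L M → map (suc b ∷_) L ++ map (suc (a ℕ.+ suc b) ∷_) M) (qsh-map-suc (a ∷ s) t) (qsh-map-suc s t)) ⟩
  map (suc a ∷_) (map (map suc) Q₁) ++ map (suc b ∷_) (map (map suc) Q₂) ++ map (suc (a ℕ.+ suc b) ∷_) (map (map suc) Q₃)
    ≡⟨ cong₂ _++_ (shift a Q₁) (cong₂ _++_ (shift b Q₂) (shift (a ℕ.+ suc b) Q₃)) ⟩
  map (map suc) (map (a ∷_) Q₁) ++ map (map suc) (map (b ∷_) Q₂) ++ map (map suc) (map (a ℕ.+ suc b ∷_) Q₃)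
    ≡⟨ cong (map (map suc) (map (a ∷_) Q₁) ++_) (List.map-++ (map suc) (map (b ∷_) Q₂) _) ⟨
  map (map suc) (map (a ∷_) Q₁) ++ map (map suc) (map (b ∷_) Q₂ ++ map (a ℕ.+ suc b ∷_) Q₃)
    ≡⟨ List.map-++ (map suc) (map (a ∷_) Q₁) _ ⟨
  map (map suc) (map (a ∷_) Q₁ ++ map (b ∷_) Q₂ ++ map (a ℕ.+ suc b ∷_) Q₃) ∎
  where
  Q₁ Q₂ Q₃ : List ZWord
  Q₁ = qsh₀ s (b ∷ t)
  Q₂ = qsh₀ (a ∷ s) t
  Q₃ = qsh₀ s t
  shift : ∀ c Q → map (suc c ∷_) (map (map suc) Q) ≡ map (map suc) (map (c ∷_) Q)
  shift c Q = trans (sym (List.map-∘ Q)) (List.map-∘ Q)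

parse-unparse₀ : ∀ t → parse (unparse₀ t) ≡ just (map suc t)
parse-unparse₀ t = trans (parseGo-parse₀-from 0 (unparse₀ t)) (cong (Maybe.map (map suc)) (parse₀-unparse₀ t))

parse-nothing : ∀ {w} → parse₀ w ≡ nothing → parse w ≡ nothing
parse-nothing {w} eq = trans (parseGo-parse₀-from 0 w) (cong (Maybe.map (map suc)) eq)

harmW-unparse₀ : ∀ s t → harmW (unparse₀ s) (unparse₀ t) ≡ map (λ r → (1ℚ , unparse₀ r)) (qsh₀ s t)
harmW-unparse₀ s t rewrite parse-unparse₀ s | parse-unparse₀ t = begin
  map (λ r → (1ℚ , unparse r)) (qsh (map suc s) (map suc t))
    ≡⟨ cong (map (λ r → (1ℚ , unparse r))) (qsh-map-suc s t) ⟩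
  map (λ r → (1ℚ , unparse r)) (map (map suc) (qsh₀ s t))      ≡⟨ List.map-∘ (qsh₀ s t) ⟨
  map (λ r → (1ℚ , unparse (map suc r))) (qsh₀ s t)
    ≡⟨ List.map-cong (λ r → cong (1ℚ ,_) (unparse-map-suc r)) (qsh₀ s t) ⟩
  map (λ r → (1ℚ , unparse₀ r)) (qsh₀ s t)                     ∎

harmW-nothingˡ : ∀ {u} v → parse u ≡ nothing → harmW u v ≡ []
harmW-nothingˡ v eq rewrite eq = refl

harmW-nothingʳ : ∀ u {v} → parse v ≡ nothing → harmW u v ≡ []
harmW-nothingʳ u eq rewrite eq with parse u
... | just _  = refl
... | nothing = refl

coeff-unparsed-supported : ∀ L → SupportedOnH¹ (coeff (map (λ r → (1ℚ , unparse₀ r)) L))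
coeff-unparsed-supported []      e = refl
coeff-unparsed-supported (r ∷ L) {w} e = trans (coeff-∷ 1ℚ (unparse₀ r) _ w)
  (cong₂ (λ a b → 1ℚ * a + b) (𝟙-unparse₀-supported r e) (coeff-unparsed-supported L e))

coeff-unparsed-unparse₀ : ∀ L t → coeff (map (λ r → (1ℚ , unparse₀ r)) L) (unparse₀ t) ≡ multiplicity t L
coeff-unparsed-unparse₀ []      t = refl
coeff-unparsed-unparse₀ (r ∷ L) t = trans (coeff-∷ 1ℚ (unparse₀ r) _ (unparse₀ t))
  (cong₂ _+_ (trans (ℚ.*-identityˡ _) (𝟙-unparse₀ r t)) (coeff-unparsed-unparse₀ L t))

-- The harmonic product on coefficient functions

extendᶻ : Coeffs ZWord → Coeffs Word
extendᶻ h w = Maybe.maybe′ h 0ℚ (parse₀ w)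

extendᶻ-unparse₀ : ∀ h t → extendᶻ h (unparse₀ t) ≡ h t
extendᶻ-unparse₀ h t = cong (Maybe.maybe′ h 0ℚ) (parse₀-unparse₀ t)

extendᶻ-supported : ∀ h → SupportedOnH¹ (extendᶻ h)
extendᶻ-supported h e = cong (Maybe.maybe′ h 0ℚ) (EndsX⇒parse₀-nothing e)

_✱ᶜ_ : Coeffs Word → Coeffs Word → Coeffs Word
f ✱ᶜ g = extendᶻ (f ∘ unparse₀ ✱ᶻ g ∘ unparse₀)

✱ᶜ-unparse₀ : ∀ f g t → (f ✱ᶜ g) (unparse₀ t) ≡ (f ∘ unparse₀ ✱ᶻ g ∘ unparse₀) t
✱ᶜ-unparse₀ f g = extendᶻ-unparse₀ _

✱ᶜ-supported : ∀ f g → SupportedOnH¹ (f ✱ᶜ g)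
✱ᶜ-supported f g = extendᶻ-supported _

✱ᶜ-isBilinear : IsBilinear _✱ᶜ_
✱ᶜ-isBilinear = record
  { linearˡ = λ g → record
    { cong-≗ = λ f≗f′ → extendᶻ-cong (✱ᶻ-cong (λ t → f≗f′ (unparse₀ t)) (λ _ → refl))
    ; linear = λ c f f′ → extendᶻ-linear c (f ∘ unparse₀ ✱ᶻ g ∘ unparse₀) (f′ ∘ unparse₀ ✱ᶻ g ∘ unparse₀)
                                          (✱ᶻ-linearˡ c _ _ _) }
  ; linearʳ = λ f → record
    { cong-≗ = λ g≗g′ → extendᶻ-cong (✱ᶻ-cong (λ _ → refl) (λ t → g≗g′ (unparse₀ t)))
    ; linear = λ c g g′ → extendᶻ-linear c (f ∘ unparse₀ ✱ᶻ g ∘ unparse₀) (f ∘ unparse₀ ✱ᶻ g′ ∘ unparse₀)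
                                          (✱ᶻ-linearʳ c _ _ _) }
  }
  where
  extendᶻ-cong : ∀ {h h′} → h ≗ h′ → extendᶻ h ≗ extendᶻ h′
  extendᶻ-cong h≗h′ w with parse₀ w
  ... | just t  = h≗h′ t
  ... | nothing = refl
  extendᶻ-linear : ∀ c h₁ h₂ {h} → h ≗ (λ t → c * h₁ t + h₂ t) →
    extendᶻ h ≗ λ w → c * extendᶻ h₁ w + extendᶻ h₂ w
  extendᶻ-linear c h₁ h₂ h≗ w with parse₀ w
  ... | just t  = h≗ t
  ... | nothing = linear-0 c

module ✱ᶜˡ (g : Coeffs Word) = IsLinear (IsBilinear.linearˡ ✱ᶜ-isBilinear g)
module ✱ᶜʳ (f : Coeffs Word) = IsLinear (IsBilinear.linearʳ ✱ᶜ-isBilinear f)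

✱ᶜ-vanishingˡ : ∀ f g → (∀ s → f (unparse₀ s) ≡ 0ℚ) → f ✱ᶜ g ≗ const 0ℚ
✱ᶜ-vanishingˡ f g f≡0 = H¹-ext (✱ᶜ-supported f g) (λ _ → refl) λ t →
  trans (✱ᶜ-unparse₀ f g t) (trans (✱ᶻ-cong f≡0 (λ _ → refl) t) (✱ᶻˡ.0-homo (g ∘ unparse₀) t))

✱ᶜ-vanishingʳ : ∀ f g → (∀ s → g (unparse₀ s) ≡ 0ℚ) → f ✱ᶜ g ≗ const 0ℚ
✱ᶜ-vanishingʳ f g g≡0 = H¹-ext (✱ᶜ-supported f g) (λ _ → refl) λ t →
  trans (✱ᶜ-unparse₀ f g t) (trans (✱ᶻ-cong (λ _ → refl) g≡0 t) (✱ᶻʳ.0-homo (f ∘ unparse₀) t))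

coeff-harmW : ∀ u v → coeff (harmW u v) ≗ 𝟙 u ✱ᶜ 𝟙 v
coeff-harmW u v with h¹View u | h¹View v
... | unparsed s | unparsed t = H¹-ext
  (subst (SupportedOnH¹ ∘ coeff) (sym (harmW-unparse₀ s t)) (coeff-unparsed-supported (qsh₀ s t)))
  (✱ᶜ-supported (𝟙 (unparse₀ s)) (𝟙 (unparse₀ t))) λ r → begin
    coeff (harmW (unparse₀ s) (unparse₀ t)) (unparse₀ r)
      ≡⟨ cong (λ p → coeff p (unparse₀ r)) (harmW-unparse₀ s t) ⟩
    coeff (map (λ r → (1ℚ , unparse₀ r)) (qsh₀ s t)) (unparse₀ r)
      ≡⟨ coeff-unparsed-unparse₀ (qsh₀ s t) r ⟩
    multiplicity r (qsh₀ s t)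
      ≡⟨ multiplicity-qsh₀ r s t ⟩
    (𝟙ᶻ s ✱ᶻ 𝟙ᶻ t) r
      ≡⟨ ✱ᶻ-cong (𝟙-unparse₀ s) (𝟙-unparse₀ t) r ⟨
    (𝟙 (unparse₀ s) ∘ unparse₀ ✱ᶻ 𝟙 (unparse₀ t) ∘ unparse₀) r
      ≡⟨ ✱ᶜ-unparse₀ (𝟙 (unparse₀ s)) (𝟙 (unparse₀ t)) r ⟨
    (𝟙 (unparse₀ s) ✱ᶜ 𝟙 (unparse₀ t)) (unparse₀ r) ∎
... | endsX e p | _ = λ w → trans (cong (λ q → coeff q w) (harmW-nothingˡ {u} v (parse-nothing {u} p)))
                                  (sym (✱ᶜ-vanishingˡ (𝟙 u) (𝟙 v) (𝟙-EndsX e) w))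
... | unparsed s | endsX e p = λ w →
  trans (cong (λ q → coeff q w) (harmW-nothingʳ (unparse₀ s) {v} (parse-nothing {v} p)))
        (sym (✱ᶜ-vanishingʳ (𝟙 (unparse₀ s)) (𝟙 v) (𝟙-EndsX e) w))

coeff-✱ : ∀ p q → coeff (p ✱ q) ≗ coeff p ✱ᶜ coeff q
coeff-✱ = coeff-bilin harmW ✱ᶜ-isBilinear coeff-harmW

✱ᶜ-identityʳ : ∀ {f} → SupportedOnH¹ f → f ✱ᶜ 𝟙 [] ≗ f
✱ᶜ-identityʳ {f} f-supp = H¹-ext (✱ᶜ-supported f (𝟙 [])) f-supp λ t →
  trans (✱ᶜ-unparse₀ f (𝟙 []) t) (trans (✱ᶻ-cong (λ _ → refl) (𝟙-unparse₀ []) t) (✱ᶻ-identityʳ (f ∘ unparse₀) t))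

δᶜ-✱ᶜ : ∀ {f g} → SupportedOnH¹ f → SupportedOnH¹ g → δᶜ (f ✱ᶜ g) ≗ λ w → (δᶜ f ✱ᶜ g) w + (f ✱ᶜ δᶜ g) w
δᶜ-✱ᶜ {f} {g} f-supp g-supp = H¹-ext (δᶜ-supported (✱ᶜ-supported f g))
  (λ e → cong₂ _+_ (✱ᶜ-supported (δᶜ f) g e) (✱ᶜ-supported f (δᶜ g) e)) λ t → begin
    δᶜ (f ✱ᶜ g) (unparse₀ t)
      ≡⟨ δᶜ-unparse₀ (✱ᶜ-supported f g) t ⟩
    δᶻ ((f ✱ᶜ g) ∘ unparse₀) t
      ≡⟨ δᶻ-cong (✱ᶜ-unparse₀ f g) t ⟩
    δᶻ (f ∘ unparse₀ ✱ᶻ g ∘ unparse₀) t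
      ≡⟨ δᶻ-✱ᶻ t (f ∘ unparse₀) (g ∘ unparse₀) ⟩
    (δᶻ (f ∘ unparse₀) ✱ᶻ g ∘ unparse₀) t + (f ∘ unparse₀ ✱ᶻ δᶻ (g ∘ unparse₀)) t
      ≡⟨ cong₂ _+_ (✱ᶻ-cong (δᶜ-unparse₀ f-supp) (λ _ → refl) t) (✱ᶻ-cong (λ _ → refl) (δᶜ-unparse₀ g-supp) t) ⟨
    (δᶜ f ∘ unparse₀ ✱ᶻ g ∘ unparse₀) t + (f ∘ unparse₀ ✱ᶻ δᶜ g ∘ unparse₀) t
      ≡⟨ cong₂ _+_ (✱ᶜ-unparse₀ (δᶜ f) g t) (✱ᶜ-unparse₀ f (δᶜ g) t) ⟨
    (δᶜ f ✱ᶜ g) (unparse₀ t) + (f ✱ᶜ δᶜ g) (unparse₀ t) ∎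

weighted : Coeffs Word → Coeffs Word
weighted f w = lengthℚ w * f w

weighted-✱ᶜ : ∀ f g → weighted (f ✱ᶜ g) ≗ λ w → (weighted f ✱ᶜ g) w + (f ✱ᶜ weighted g) w
weighted-✱ᶜ f g = H¹-ext (λ {w} e → trans (cong (lengthℚ w *_) (✱ᶜ-supported f g e)) (ℚ.*-zeroʳ (lengthℚ w)))
  (λ e → cong₂ _+_ (✱ᶜ-supported (weighted f) g e) (✱ᶜ-supported f (weighted g) e)) λ t → begin
    lengthℚ (unparse₀ t) * (f ✱ᶜ g) (unparse₀ t)
      ≡⟨ cong₂ _*_ (lengthℚ-unparse₀ t) (✱ᶜ-unparse₀ f g t) ⟩
    weightᶻ t * (f ∘ unparse₀ ✱ᶻ g ∘ unparse₀) t
      ≡⟨ weightedᶻ-✱ᶻ t (f ∘ unparse₀) (g ∘ unparse₀) ⟩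
    (weightedᶻ (f ∘ unparse₀) ✱ᶻ g ∘ unparse₀) t + (f ∘ unparse₀ ✱ᶻ weightedᶻ (g ∘ unparse₀)) t
      ≡⟨ cong₂ _+_ (✱ᶻ-cong (weighted-unparse₀ f) (λ _ → refl) t) (✱ᶻ-cong (λ _ → refl) (weighted-unparse₀ g) t) ⟨
    (weighted f ∘ unparse₀ ✱ᶻ g ∘ unparse₀) t + (f ∘ unparse₀ ✱ᶻ weighted g ∘ unparse₀) t
      ≡⟨ cong₂ _+_ (✱ᶜ-unparse₀ (weighted f) g t) (✱ᶜ-unparse₀ f (weighted g) t) ⟨
    (weighted f ✱ᶜ g) (unparse₀ t) + (f ✱ᶜ weighted g) (unparse₀ t) ∎
  where
  weighted-unparse₀ : ∀ h → weighted h ∘ unparse₀ ≗ weightedᶻ (h ∘ unparse₀)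
  weighted-unparse₀ h s = cong (_* h (unparse₀ s)) (lengthℚ-unparse₀ s)

-- φ and R

xy : Word
xy = x ∷ y ∷ []

φᶜ : Coeffs Word → Coeffs Word
φᶜ f w = (f ✱ᶜ 𝟙 xy) w - shuffle-xyᶜ f w

Rᶜ : Coeffs Word → Coeffs Word → Coeffs Word
Rᶜ f g w = φᶜ (f ✱ᶜ g) w - (φᶜ f ✱ᶜ g) w - (f ✱ᶜ φᶜ g) w

φᶜ-isLinear : IsLinear φᶜ
φᶜ-isLinear = record
  { cong-≗ = λ f≗g w → cong₂ _-_ (✱ᶜˡ.cong-≗ (𝟙 xy) f≗g w) (XY.cong-≗ f≗g w)
  ; linear = λ c f g w → trans (cong₂ _-_ (✱ᶜˡ.linear (𝟙 xy) c f g w) (XY.linear c f g w))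
      (solve 5 (λ c a b d e → c :* a :+ b :- (c :* d :+ e) := c :* (a :- d) :+ (b :- e)) refl
         c ((f ✱ᶜ 𝟙 xy) w) ((g ✱ᶜ 𝟙 xy) w) (shuffle-xyᶜ f w) (shuffle-xyᶜ g w))
  }

module Φ = IsLinear φᶜ-isLinear

φᶜ-supported : ∀ {f} → SupportedOnH¹ f → SupportedOnH¹ (φᶜ f)
φᶜ-supported {f} f-supp e = cong₂ _-_ (✱ᶜ-supported f (𝟙 xy) e) (shuffle-xyᶜ-supported f-supp e)

δᶜ-𝟙xy : δᶜ (𝟙 xy) ≗ λ w → -½ * 𝟙 [] w
δᶜ-𝟙xy w = trans (sym (coeff-δW xy w)) (coeff-single -½ [] w)

δᶜ-φᶜ : ∀ {f} → SupportedOnH¹ f → δᶜ (φᶜ f) ≗ λ w → φᶜ (δᶜ f) w + weighted f w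
δᶜ-φᶜ {f} f-supp w = begin
  δᶜ (φᶜ f) w
    ≡⟨ Δ.sub-homo (f ✱ᶜ 𝟙 xy) (shuffle-xyᶜ f) w ⟩
  δᶜ (f ✱ᶜ 𝟙 xy) w - δᶜ (shuffle-xyᶜ f) w
    ≡⟨ cong₂ _-_ (δᶜ-✱ᶜ f-supp (𝟙-unparse₀-supported (1 ∷ [])) w) (δᶜ-shuffle-xyᶜ f-supp w) ⟩
  (δᶜ f ✱ᶜ 𝟙 xy) w + (f ✱ᶜ δᶜ (𝟙 xy)) w - (shuffle-xyᶜ (δᶜ f) w - ½ * f w - lengthℚ w * f w)
    ≡⟨ cong (λ a → (δᶜ f ✱ᶜ 𝟙 xy) w + a - (shuffle-xyᶜ (δᶜ f) w - ½ * f w - lengthℚ w * f w)) f✱δxy ⟩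
  (δᶜ f ✱ᶜ 𝟙 xy) w + -½ * f w - (shuffle-xyᶜ (δᶜ f) w - ½ * f w - lengthℚ w * f w)
    ≡⟨ solve 4 (λ A F S L → A :+ :- con ½ :* F :- (S :- con ½ :* F :- L :* F) := A :- S :+ L :* F)
         refl ((δᶜ f ✱ᶜ 𝟙 xy) w) (f w) (shuffle-xyᶜ (δᶜ f) w) (lengthℚ w) ⟩
  φᶜ (δᶜ f) w + weighted f w ∎
  where
  f✱δxy : (f ✱ᶜ δᶜ (𝟙 xy)) w ≡ -½ * f w
  f✱δxy = begin
    (f ✱ᶜ δᶜ (𝟙 xy)) w          ≡⟨ ✱ᶜʳ.cong-≗ f δᶜ-𝟙xy w ⟩
    (f ✱ᶜ (λ v → -½ * 𝟙 [] v)) w ≡⟨ ✱ᶜʳ.*-homo f -½ (𝟙 []) w ⟩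
    -½ * (f ✱ᶜ 𝟙 []) w           ≡⟨ cong (-½ *_) (✱ᶜ-identityʳ f-supp w) ⟩
    -½ * f w                     ∎

δᶜ-Rᶜ : ∀ {f g} → SupportedOnH¹ f → SupportedOnH¹ g → δᶜ (Rᶜ f g) ≗ λ w → Rᶜ (δᶜ f) g w + Rᶜ f (δᶜ g) w
δᶜ-Rᶜ {f} {g} f-supp g-supp w = begin
  δᶜ (Rᶜ f g) w
    ≡⟨ Δ.sub-homo (λ v → φᶜ (f ✱ᶜ g) v - (φᶜ f ✱ᶜ g) v) (f ✱ᶜ φᶜ g) w ⟩
  δᶜ (λ v → φᶜ (f ✱ᶜ g) v - (φᶜ f ✱ᶜ g) v) w - δᶜ (f ✱ᶜ φᶜ g) w
    ≡⟨ cong (_- δᶜ (f ✱ᶜ φᶜ g) w) (Δ.sub-homo (φᶜ (f ✱ᶜ g)) (φᶜ f ✱ᶜ g) w) ⟩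
  δᶜ (φᶜ (f ✱ᶜ g)) w - δᶜ (φᶜ f ✱ᶜ g) w - δᶜ (f ✱ᶜ φᶜ g) w
    ≡⟨ cong₂ _-_ (cong₂ _-_ δφ[f✱g] δ[φf✱g]) δ[f✱φg] ⟩
  P₁ + P₂ + (W₁ + W₂) - (Q₁ + W₁ + Q₂) - (Q₃ + (Q₄ + W₂))
    ≡⟨ solve 8 (λ P₁ P₂ W₁ W₂ Q₁ Q₂ Q₃ Q₄ →
         P₁ :+ P₂ :+ (W₁ :+ W₂) :- (Q₁ :+ W₁ :+ Q₂) :- (Q₃ :+ (Q₄ :+ W₂))
         := P₁ :- Q₁ :- Q₃ :+ (P₂ :- Q₂ :- Q₄)) refl P₁ P₂ W₁ W₂ Q₁ Q₂ Q₃ Q₄ ⟩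
  Rᶜ (δᶜ f) g w + Rᶜ f (δᶜ g) w ∎
  where
  P₁ P₂ W₁ W₂ Q₁ Q₂ Q₃ Q₄ : ℚ
  P₁ = φᶜ (δᶜ f ✱ᶜ g) w
  P₂ = φᶜ (f ✱ᶜ δᶜ g) w
  W₁ = (weighted f ✱ᶜ g) w
  W₂ = (f ✱ᶜ weighted g) w
  Q₁ = (φᶜ (δᶜ f) ✱ᶜ g) w
  Q₂ = (φᶜ f ✱ᶜ δᶜ g) w
  Q₃ = (δᶜ f ✱ᶜ φᶜ g) w
  Q₄ = (f ✱ᶜ φᶜ (δᶜ g)) w
  δφ[f✱g] : δᶜ (φᶜ (f ✱ᶜ g)) w ≡ P₁ + P₂ + (W₁ + W₂)
  δφ[f✱g] = begin
    δᶜ (φᶜ (f ✱ᶜ g)) w                   ≡⟨ δᶜ-φᶜ (✱ᶜ-supported f g) w ⟩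
    φᶜ (δᶜ (f ✱ᶜ g)) w + weighted (f ✱ᶜ g) w
      ≡⟨ cong₂ _+_ (trans (Φ.cong-≗ (δᶜ-✱ᶜ f-supp g-supp) w) (Φ.+-homo (δᶜ f ✱ᶜ g) (f ✱ᶜ δᶜ g) w))
                   (weighted-✱ᶜ f g w) ⟩
    P₁ + P₂ + (W₁ + W₂)                  ∎
  δ[φf✱g] : δᶜ (φᶜ f ✱ᶜ g) w ≡ Q₁ + W₁ + Q₂
  δ[φf✱g] = begin
    δᶜ (φᶜ f ✱ᶜ g) w                     ≡⟨ δᶜ-✱ᶜ (φᶜ-supported f-supp) g-supp w ⟩
    (δᶜ (φᶜ f) ✱ᶜ g) w + Q₂
      ≡⟨ cong (_+ Q₂) (trans (✱ᶜˡ.cong-≗ g (δᶜ-φᶜ f-supp) w) (✱ᶜˡ.+-homo g (φᶜ (δᶜ f)) (weighted f) w)) ⟩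
    Q₁ + W₁ + Q₂                         ∎
  δ[f✱φg] : δᶜ (f ✱ᶜ φᶜ g) w ≡ Q₃ + (Q₄ + W₂)
  δ[f✱φg] = begin
    δᶜ (f ✱ᶜ φᶜ g) w                     ≡⟨ δᶜ-✱ᶜ f-supp (φᶜ-supported g-supp) w ⟩
    Q₃ + (f ✱ᶜ δᶜ (φᶜ g)) w
      ≡⟨ cong (Q₃ +_) (trans (✱ᶜʳ.cong-≗ f (δᶜ-φᶜ g-supp) w) (✱ᶜʳ.+-homo f (φᶜ (δᶜ g)) (weighted g) w)) ⟩
    Q₃ + (Q₄ + W₂)                       ∎

coeff-φ : ∀ p → coeff (φ p) ≗ φᶜ (coeff p)
coeff-φ p w = trans (coeff-⊖ (p ✱ z₂) (p ⧢ z₂) w) (cong₂ _-_ (coeff-✱ p z₂ w) (coeff-⧢z₂ p w))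

Rᶜ-cong : ∀ {f f′ g g′} → f ≗ f′ → g ≗ g′ → Rᶜ f g ≗ Rᶜ f′ g′
Rᶜ-cong {f} {f′} {g} {g′} f≗ g≗ w = cong₂ _-_ (cong₂ _-_
  (Φ.cong-≗ (λ v → trans (✱ᶜˡ.cong-≗ g f≗ v) (✱ᶜʳ.cong-≗ f′ g≗ v)) w)
  (trans (✱ᶜˡ.cong-≗ g (Φ.cong-≗ f≗) w) (✱ᶜʳ.cong-≗ (φᶜ f′) g≗ w)))
  (trans (✱ᶜˡ.cong-≗ (φᶜ g) f≗ w) (✱ᶜʳ.cong-≗ f′ (Φ.cong-≗ g≗) w))

coeff-R : ∀ p q → coeff (R p q) ≗ Rᶜ (coeff p) (coeff q)
coeff-R p q w = begin
  coeff (R p q) w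
    ≡⟨ trans (coeff-⊖ (φ (p ✱ q) ⊖ (φ p ✱ q)) (p ✱ φ q) w) (cong (_- coeff (p ✱ φ q) w) (coeff-⊖ (φ (p ✱ q)) (φ p ✱ q) w)) ⟩
  coeff (φ (p ✱ q)) w - coeff (φ p ✱ q) w - coeff (p ✱ φ q) w
    ≡⟨ cong₂ _-_ (cong₂ _-_ (coeff-φ (p ✱ q) w) (coeff-✱ (φ p) q w)) (coeff-✱ p (φ q) w) ⟩
  φᶜ (coeff (p ✱ q)) w - (coeff (φ p) ✱ᶜ coeff q) w - (coeff p ✱ᶜ coeff (φ q)) w
    ≡⟨ Rᶜ-parts ⟩
  Rᶜ (coeff p) (coeff q) w ∎
  where
  Rᶜ-parts : φᶜ (coeff (p ✱ q)) w - (coeff (φ p) ✱ᶜ coeff q) w - (coeff p ✱ᶜ coeff (φ q)) w ≡ Rᶜ (coeff p) (coeff q) w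
  Rᶜ-parts = cong₂ _-_ (cong₂ _-_ (Φ.cong-≗ (coeff-✱ p q) w) (✱ᶜˡ.cong-≗ (coeff q) (coeff-φ p) w))
                       (✱ᶜʳ.cong-≗ (coeff p) (coeff-φ q) w)

lemma3p6 : (u v : Poly) → InH1 u → InH1 v →
    δ (R u v) ≈ R (δ u) v ⊕ R u (δ v)
lemma3p6 u v u∈H¹ v∈H¹ w = begin
  coeff (δ (R u v)) w
    ≡⟨ trans (coeff-δ (R u v) w) (Δ.cong-≗ (coeff-R u v) w) ⟩
  δᶜ (Rᶜ (coeff u) (coeff v)) w
    ≡⟨ δᶜ-Rᶜ (coeff-supportedOnH¹ u u∈H¹) (coeff-supportedOnH¹ v v∈H¹) w ⟩
  Rᶜ (δᶜ (coeff u)) (coeff v) w + Rᶜ (coeff u) (δᶜ (coeff v)) w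
    ≡⟨ cong₂ _+_ (trans (coeff-R (δ u) v w) (Rᶜ-cong (coeff-δ u) (λ _ → refl) w))
                 (trans (coeff-R u (δ v) w) (Rᶜ-cong (λ _ → refl) (coeff-δ v) w)) ⟨
  coeff (R (δ u) v) w + coeff (R u (δ v)) w
    ≡⟨ coeff-++ (R (δ u) v) (R u (δ v)) w ⟨
  coeff (R (δ u) v ⊕ R u (δ v)) w ∎
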